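{- Let $D$ be a connected Eulerian multi-digraph, let $u\in V(D)$ and let $e\in E(D)$. Let $g$ map each closed trail $\mathbf w$ of $D$ with cycle sequence $\mathrm{cs}(\mathbf w)=(\beta_1,\dots,\beta_m)$ to the heap $\beta_1\circ\cdots\circ\beta_m$. Then: (1) the restriction of $g$ to the set $\mathcal W^e(D)$ of Eulerian trails of $D$ ending at $e$ is a bijection onto the set $\mathrm{dp}^e(D)$ of decomposition pyramids of $D$ whose maximal piece contains $e$; (2) the restriction of $g$ to the set $\mathcal W^u(D)$ of Eulerian trails of $D$ at $u$ is a bijection onto the set $\mathrm{dp}^u(D)$ of decomposition pyramids of $D$ whose maximal piece contains $u$.
   Context: A multi-digraph $D$ has finite vertex set $V(D)$, finite arc set $E(D)$ and a map $\psi:E(D)\to V(D)\times V(D)$ with distinct coordinates (no loops; parallel arcs allowed). $D$ is Eulerian if it has a closed trail using every arc exactly once. A closed trail at $v_0$ is a sequence $(v_0,e_1,v_1,\dots,e_d,v_d)$ with $v_d=v_0$, $\psi(e_i)=(v_{i-1},v_i)$ and the $e_i$ pairwise distinct; an Eulerian trail is one with $\{e_1,\dots,e_d\}=E(D)$; it is at $u$ if $v_0=u$, and ends at $e$ if $e_d=e$. A cycle is an equivalence class, under cyclic rotation of the arc sequence, of closed trails of positive length with no repeated vertex other than $v_0=v_d$; $\mathcal B(D)$ is the set of cycles; $V(\beta),E(\beta)$ denote its vertex and arc sets. Cycle sequence: for a closed trail $\mathbf w=(v_0,e_1,\dots,e_d,v_d)$ of length $0$, $\mathrm{cs}(\mathbf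 w)$ is empty. If $d\ge1$, let $t$ be the smallest index for which $v_t=v_s$ for some $s<t$ ($s$ is then unique); the subtrail $(v_s,e_{s+1},\dots,e_t,v_t)$ determines a cycle $\beta_1$; deleting it gives the closed trail $\mathbf w'=(v_0,e_1,\dots,e_s,v_s,e_{t+1},\dots,e_d,v_d)$, and $\mathrm{cs}(\mathbf w)=(\beta_1,\mathrm{cs}(\mathbf w'))$ (concatenation). Heaps: pieces are the elements of $\mathcal B(D)$, two pieces being concurrent iff they share a vertex. A heap is a finite poset $(\Omega,\le)$ with a labeling $\ell:\Omega\to\mathcal B(D)$ such that elements with concurrent labels are comparable and if $y$ covers $x$ then $\ell(x),\ell(y)$ are concurrent; heaps are considered up to label-preserving poset isomorphism. For pieces $\beta_1,\dots,\beta_m$, the heap $\beta_1\circ\cdots\circ\beta_m$ has ground set $\{1,\dots,m\}$, $\ell(i)=\beta_i$, and order the reflexive–transitive closure of $\{(i,j):i<j,\ \beta_i,\beta_j\text{ concurrent}\}$. A pyramid is a heap with a unique maximal element (its maximal piece). A decomposition pyramid of $D$ is a pyramid whose labels' arc sets $E(\ell(x))$, $x\in\Omega$, form a partition of $E(D)$. -}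

module Defs where

open import Level using (0ℓ)
open import Data.Nat using (ℕ; zero; suc; _<_)
open import Data.Fin using (Fin; toℕ; _≟_)
open import Data.Product using (Σ; ∃; ∃-syntax; _×_; _,_; proj₁; proj₂)
open import Data.Sum using (_⊎_)
open import Data.Maybe using (Maybe; just; nothing; fromMaybe)
import Data.Maybe as Maybe
open import Data.List using (List; []; _∷_; _++_; _∷ʳ_; [_]; map; take; drop; length; head; lookup)
open import Data.List.Membership.Propositional using (_∈_)
open import Data.List.Relation.Unary.Unique.Propositional using (Unique)
open import Relation.Binary.PropositionalEquality using (_≡_; _≢_)
open import Relation.Binary.Construct.Closure.ReflexiveTransitive using (Star)
open import Relation.Nullary using (yes; no; ¬_)
open import Function.Bundles using (_↔_; Inverse)

record MultiDigraph : Set where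
  field
    nV nE  : ℕ
    ψ      : Fin nE → Fin nV × Fin nV
    noLoop : ∀ a → proj₁ (ψ a) ≢ proj₂ (ψ a)

module _ (D : MultiDigraph) where
  open MultiDigraph D

  V E : Set
  V = Fin nV
  E = Fin nE

  src tgt : E → V
  src a = proj₁ (ψ a)
  tgt a = proj₂ (ψ a)

  Adj : V → V → Set
  Adj x y = ∃[ a ] (ψ a ≡ (x , y) ⊎ ψ a ≡ (y , x))

  Connected : Set
  Connected = ∀ x y → Star Adj x y

  -- A trail is given by its start vertex v₀ and its arc list (e₁,…,e_d);
  -- the vertices v₁,…,v_d are the heads of the arcs.
  data IsWalk : V → List E → V → Set where
    nil  : ∀ {v} → IsWalk v [] v
    cons : ∀ {v w a as} → src a ≡ v → IsWalk (tgt a) as w → IsWalk v (a ∷ as) w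

  IsClosedTrail : V → List E → Set
  IsClosedTrail v₀ es = IsWalk v₀ es v₀ × Unique es

  IsEulerianTrail : V → List E → Set
  IsEulerianTrail v₀ es = IsClosedTrail v₀ es × (∀ a → a ∈ es)

  Eulerian : Set
  Eulerian = ∃[ v₀ ] ∃[ es ] IsEulerianTrail v₀ es

  EndsAt : E → List E → Set
  EndsAt a es = ∃[ xs ] es ≡ xs ∷ʳ a

  vertSeq : V → List E → List V
  vertSeq v₀ es = v₀ ∷ map tgt es

  -- Cycles.  A representative is a closed trail (v₀, es); cycles are
  -- representatives up to cyclic rotation of the arc sequence.

  Cyc : Set
  Cyc = V × List E

  IsCycle : Cyc → Set
  IsCycle (v₀ , es) = IsClosedTrail v₀ es × ¬ (es ≡ []) × Unique (map tgt es)

  -- rotation equivalence (for cycles the start vertex is the tail of the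
  -- first arc, so it is determined by the arc sequence)
  CycEq : Cyc → Cyc → Set
  CycEq (_ , es) (_ , es') = ∃[ xs ] ∃[ ys ] (es ≡ xs ++ ys × es' ≡ ys ++ xs)

  cycVerts : Cyc → List V
  cycVerts (v₀ , es) = vertSeq v₀ es

  cycArcs : Cyc → List E
  cycArcs = proj₂

  Concurrent : Cyc → Cyc → Set
  Concurrent β γ = ∃[ x ] (x ∈ cycVerts β × x ∈ cycVerts γ)

  indexOf : V → List V → Maybe ℕ
  indexOf x [] = nothing
  indexOf x (y ∷ ys) with x ≟ y
  ... | yes _ = just 0
  ... | no _  = Maybe.map suc (indexOf x ys)

  -- scanning v_t, v_{t+1}, … with `seen` = (v₀,…,v_{t-1}); returns the
  -- smallest t with v_t = v_s for some s < t, together with s.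
  firstRepeatAux : List V → ℕ → List V → Maybe (ℕ × ℕ)
  firstRepeatAux seen t [] = nothing
  firstRepeatAux seen t (x ∷ xs) with indexOf x seen
  ... | just s  = just (s , t)
  ... | nothing = firstRepeatAux (seen ∷ʳ x) (suc t) xs

  firstRepeat : List V → Maybe (ℕ × ℕ)
  firstRepeat [] = nothing
  firstRepeat (x ∷ xs) = firstRepeatAux [ x ] 1 xs

  -- fuel = number of arcs (each step removes at least one arc)
  csAux : ℕ → V → List E → List Cyc
  csAux zero v₀ es = []
  csAux (suc k) v₀ es with firstRepeat (vertSeq v₀ es)
  ... | nothing = []
  ... | just (s , t) =
        (fromMaybe v₀ (head (drop s (vertSeq v₀ es))) , drop s (take t es))
        ∷ csAux k v₀ (take s es ++ drop t es)

  cs : V → List E → List Cyc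
  cs v₀ es = csAux (length es) v₀ es

  record Heap : Set₁ where
    field
      size  : ℕ
      _≤ₕ_  : Fin size → Fin size → Set
      label : Fin size → Cyc

  module _ (H : Heap) where
    open Heap H

    _<ₕ_ : Fin size → Fin size → Set
    x <ₕ y = x ≤ₕ y × x ≢ y

    Covers : Fin size → Fin size → Set   -- Covers x y : y covers x
    Covers x y = x <ₕ y × (∀ z → ¬ (x <ₕ z × z <ₕ y))

    record IsHeap : Set where
      field
        refl′     : ∀ x → x ≤ₕ x
        antisym   : ∀ x y → x ≤ₕ y → y ≤ₕ x → x ≡ y
        trans′    : ∀ x y z → x ≤ₕ y → y ≤ₕ z → x ≤ₕ z
        labelsCyc : ∀ x → IsCycle (label x)
        concComp  : ∀ x y → Concurrent (label x) (label y) → x ≤ₕ y ⊎ y ≤ₕ x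
        coverConc : ∀ x y → Covers x y → Concurrent (label x) (label y)

    IsMaximal : Fin size → Set
    IsMaximal x = ∀ y → x ≤ₕ y → y ≡ x

    IsMaxPiece : Fin size → Set
    IsMaxPiece top = IsMaximal top × (∀ x → IsMaximal x → x ≡ top)

    IsDecomposition : Set
    IsDecomposition =
      ∀ a → (∃[ x ] a ∈ cycArcs (label x))
          × (∀ x y → a ∈ cycArcs (label x) → a ∈ cycArcs (label y) → x ≡ y)

    IsDecompPyramidWith : (Cyc → Set) → Set
    IsDecompPyramidWith P =
      IsHeap × IsDecomposition × ∃[ top ] (IsMaxPiece top × P (label top))

  record HeapIso (H H' : Heap) : Set where
    open Heap H
    open Heap H' renaming (size to size'; _≤ₕ_ to _≤'_; label to label')
    field
      σ        : Fin size ↔ Fin size'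
    open Inverse σ
    field
      ordIso   : ∀ x y → (x ≤ₕ y → to x ≤' to y) × (to x ≤' to y → x ≤ₕ y)
      labelIso : ∀ x → CycEq (label x) (label' (to x))

  heapOf : List Cyc → Heap
  heapOf βs = record
    { size  = length βs
    ; _≤ₕ_  = Star (λ i j → (toℕ i < toℕ j) × Concurrent (lookup βs i) (lookup βs j))
    ; label = lookup βs
    }

  g : V → List E → Heap
  g v₀ es = heapOf (cs v₀ es)

  GBijection : (V → List E → Set) → (Heap → Set) → Set₁
  GBijection W Q =
      (∀ v₀ es → W v₀ es → Q (g v₀ es))
    × (∀ v₀ es v₀' es' → W v₀ es → W v₀' es' →
         HeapIso (g v₀ es) (g v₀' es') → (v₀ , es) ≡ (v₀' , es'))
    × (∀ H → Q H → ∃[ v₀ ] ∃[ es ] (W v₀ es × HeapIso (g v₀ es) H))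

  Wᵉ : E → V → List E → Set
  Wᵉ a v₀ es = IsEulerianTrail v₀ es × EndsAt a es

  dpᵉ : E → Heap → Set
  dpᵉ a H = IsDecompPyramidWith H (λ β → a ∈ cycArcs β)

  Wᵘ : V → V → List E → Set
  Wᵘ u v₀ es = IsEulerianTrail v₀ es × v₀ ≡ u

  dpᵘ : V → Heap → Set
  dpᵘ u H = IsDecompPyramidWith H (λ β → u ∈ cycVerts β)

-- Peeling off, one at a time, the first cycle to close along a closed trail
-- yields its cycle sequence.  The last cycle to close contains the start vertex
-- and the last arc, and every earlier cycle meets the trail that remains after
-- its removal, so β₁ ∘ ⋯ ∘ βₘ is a pyramid with that cycle on top.  Of two arcs
-- leaving the same vertex, the one used first lies on a cycle that closes
-- first; hence the heap records the order in which the trail leaves each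
-- vertex, and together with the start vertex this determines the trail.
-- Conversely, list the pieces of a decomposition pyramid so that concurrent
-- pieces appear in heap order, ending with the maximal piece.  Starting from
-- the maximal piece, rotated to start at u (or to end with e), splice the other
-- pieces in backwards, each at the first vertex it shares with the current
-- trail: it becomes the first cycle to close, and it commutes in the heap past
-- the earlier cycles, none of which it meets.  The heap of the final trail is
-- then the given pyramid.

module Submission where

open import Defs
open import Data.Product using (_×_)

open import Data.Nat using (ℕ; zero; suc; _+_; _≤_; _<_; z≤n; s≤s)
import Data.Nat.Properties as ℕ
open import Data.List.Extrema ℕ.≤-totalOrder using (argmin; argmin-all; f[argmin]≤f[xs])
open import Data.Fin using (Fin; toℕ; _≟_) renaming (zero to fz; suc to fs)
import Data.Fin.Properties as Fin
open import Data.Product using (∃; ∃-syntax; ∃₂; _,_; proj₁; proj₂)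
open import Data.Sum using (_⊎_; inj₁; inj₂)
open import Data.Empty using (⊥; ⊥-elim)
open import Data.Unit using (⊤; tt)
open import Data.Maybe using (just; nothing; fromMaybe)
open import Data.List using (List; []; _∷_; _++_; _∷ʳ_; [_]; map; take; drop; length; lookup; concat; initLast; _∷ʳ′_; filter; allFin)
import Data.List.Properties as List
open import Data.List.Membership.Propositional using (_∈_; _∉_; find)
open import Data.List.Membership.Propositional.Properties using (∈-++⁺ˡ; ∈-++⁺ʳ; ∈-++⁻; ∈-insert; ∈-lookup; ∈-∃++; ∈-map⁺; ∈-map⁻; ∈-filter⁺; ∈-filter⁻; ∈-allFin)
open import Data.List.Relation.Unary.Any using (Any; here; there)
import Data.List.Relation.Unary.Any as Any
open import Data.List.Relation.Unary.Any.Properties using (lookup-index)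
open import Data.List.Relation.Unary.All using (All; []; _∷_)
import Data.List.Relation.Unary.All as All
import Data.List.Relation.Unary.All.Properties as All
open import Data.List.Relation.Unary.AllPairs using ([]; _∷_)
import Data.List.Relation.Unary.AllPairs as AllPairs
open import Data.List.Relation.Unary.Unique.Propositional using (Unique)
import Data.List.Relation.Unary.Unique.Propositional.Properties as Unique
open import Data.List.Relation.Binary.Pointwise using (Pointwise; []; _∷_)
open import Data.List.Relation.Binary.Permutation.Propositional using (_↭_; ↭-refl; ↭-reflexive; ↭-sym; ↭-trans; ↭⇒↭ₛ′)
import Data.List.Relation.Binary.Permutation.Propositional.Properties as Perm
import Data.List.Relation.Binary.Permutation.Setoid.Properties as PermSetoid
open import Relation.Binary.PropositionalEquality using (_≡_; _≢_; refl; sym; trans; cong; cong₂; subst; subst₂; setoid; isEquivalence; module ≡-Reasoning)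
open import Relation.Nullary using (Dec; yes; no; ¬_; ¬?; _×-dec_; _→-dec_; ¬¬-excluded-middle)
open import Relation.Nullary.Decidable using (decidable-stable)
open import Function.Base using (_∘_; case_of_)
open import Function.Bundles using (Inverse; mk↔ₛ′)
open import Relation.Binary using (tri<; tri≈; tri>)
open import Relation.Binary.Construct.Closure.ReflexiveTransitive using (Star; ε; _◅_; _◅◅_)
import Relation.Binary.Construct.Closure.ReflexiveTransitive as Star

module _ {A : Set} where

  unique-resp-↭ : {xs ys : List A} → xs ↭ ys → Unique xs → Unique ys
  unique-resp-↭ p = PermSetoid.Unique-resp-↭ (setoid A) (↭⇒↭ₛ′ isEquivalence p)

  take-length-++ : ∀ (xs ys : List A) → take (length xs) (xs ++ ys) ≡ xs
  take-length-++ []       ys = refl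
  take-length-++ (x ∷ xs) ys = cong (x ∷_) (take-length-++ xs ys)

  drop-length-++ : ∀ (xs ys : List A) → drop (length xs) (xs ++ ys) ≡ ys
  drop-length-++ []       ys = refl
  drop-length-++ (_ ∷ xs) ys = drop-length-++ xs ys

  take-length-+-++ : ∀ (xs : List A) n ys → take (length xs + n) (xs ++ ys) ≡ xs ++ take n ys
  take-length-+-++ []       n ys = refl
  take-length-+-++ (x ∷ xs) n ys = cong (x ∷_) (take-length-+-++ xs n ys)

  drop-length-+-++ : ∀ (xs : List A) n ys → drop (length xs + n) (xs ++ ys) ≡ drop n ys
  drop-length-+-++ []       n ys = refl
  drop-length-+-++ (_ ∷ xs) n ys = drop-length-+-++ xs n ys

  ++-≡-++⁻ : ∀ (as bs cs ds : List A) → as ++ bs ≡ cs ++ ds →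
    (∃[ ks ] (cs ≡ as ++ ks × bs ≡ ks ++ ds)) ⊎ (∃[ ks ] (as ≡ cs ++ ks × ds ≡ ks ++ bs))
  ++-≡-++⁻ []       bs cs       ds eq = inj₁ (cs , refl , eq)
  ++-≡-++⁻ (a ∷ as) bs []       ds eq = inj₂ (a ∷ as , refl , sym eq)
  ++-≡-++⁻ (a ∷ as) bs (c ∷ cs) ds eq with List.∷-injective eq
  ... | refl , eq′ with ++-≡-++⁻ as bs cs ds eq′
  ... | inj₁ (ks , e₁ , e₂) = inj₁ (ks , cong (a ∷_) e₁ , e₂)
  ... | inj₂ (ks , e₁ , e₂) = inj₂ (ks , cong (a ∷_) e₁ , e₂)

  map-≡-++⁻ : ∀ {B : Set} (f : B → A) xs as bs → map f xs ≡ as ++ bs →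
    ∃₂ λ xs₁ xs₂ → xs ≡ xs₁ ++ xs₂ × map f xs₁ ≡ as × map f xs₂ ≡ bs
  map-≡-++⁻ f xs       []       bs eq = [] , xs , refl , refl , eq
  map-≡-++⁻ f []       (a ∷ as) bs ()
  map-≡-++⁻ f (x ∷ xs) (a ∷ as) bs eq with List.∷-injective eq
  ... | e₁ , e₂ with map-≡-++⁻ f xs as bs e₂
  ... | xs₁ , xs₂ , q₁ , q₂ , q₃ = x ∷ xs₁ , xs₂ , cong (x ∷_) q₁ , cong₂ _∷_ e₁ q₂ , q₃

  ∷ʳ≢[] : ∀ (xs : List A) {a} → xs ∷ʳ a ≢ []
  ∷ʳ≢[] []      ()
  ∷ʳ≢[] (_ ∷ _) ()

  ≢[]⇒∷ʳ : ∀ (xs : List A) → xs ≢ [] → ∃₂ λ ys a → xs ≡ ys ∷ʳ a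
  ≢[]⇒∷ʳ xs xs≢[] with initLast xs
  ... | []       = ⊥-elim (xs≢[] refl)
  ... | ys ∷ʳ′ a = ys , a , refl

  unique-++⁻ˡ : ∀ (xs : List A) {ys} → Unique (xs ++ ys) → Unique xs
  unique-++⁻ˡ []       u       = []
  unique-++⁻ˡ (x ∷ xs) (a ∷ u) = All.++⁻ˡ xs a ∷ unique-++⁻ˡ xs u

  unique-++⁻ʳ : ∀ (xs : List A) {ys} → Unique (xs ++ ys) → Unique ys
  unique-++⁻ʳ []       u       = u
  unique-++⁻ʳ (x ∷ xs) (a ∷ u) = unique-++⁻ʳ xs u

  unique-++⇒disjoint : ∀ (xs : List A) {ys x} → Unique (xs ++ ys) → x ∈ xs → x ∈ ys → ⊥
  unique-++⇒disjoint (y ∷ xs) (a ∷ u) (here refl) m = All.lookup (All.++⁻ʳ xs a) m refl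
  unique-++⇒disjoint (y ∷ xs) (a ∷ u) (there i)   m = unique-++⇒disjoint xs u i m

  unique-++⁺ : ∀ {xs ys : List A} → Unique xs → Unique ys → (∀ {x} → x ∈ xs → x ∈ ys → ⊥) → Unique (xs ++ ys)
  unique-++⁺ u v d = Unique.++⁺ u v (λ (p , q) → d p q)

  unique-∷⁺ : ∀ {x : A} {xs} → x ∉ xs → Unique xs → Unique (x ∷ xs)
  unique-∷⁺ {x} {xs} x∉ u = All.tabulate (λ {y} m eq → x∉ (subst (_∈ xs) (sym eq) m)) ∷ u

  unique-middle⇒∉prefix : ∀ (xs : List A) {x ys} → Unique (xs ++ x ∷ ys) → x ∉ xs
  unique-middle⇒∉prefix xs u m = unique-++⇒disjoint xs u m (here refl)

  unique-lookup-index : ∀ {x : A} {xs} → Unique xs → (m : x ∈ xs) → ∀ i → lookup xs i ≡ x → Any.index m ≡ i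
  unique-lookup-index (u ∷ us) (here refl) fz     e    = refl
  unique-lookup-index (u ∷ us) (here refl) (fs i) e    = ⊥-elim (All.lookup u (subst (_∈ _) e (∈-lookup i)) refl)
  unique-lookup-index (u ∷ us) (there m)   fz     refl = ⊥-elim (All.lookup u m refl)
  unique-lookup-index (u ∷ us) (there m)   (fs i) e    = cong fs (unique-lookup-index us m i e)

  unique-map⇒injective : ∀ {B : Set} (f : A → B) {xs a b} → Unique (map f xs) → a ∈ xs → b ∈ xs → f a ≡ f b → a ≡ b
  unique-map⇒injective f (_ ∷ _)  (here refl) (here refl) _ = refl
  unique-map⇒injective f (u ∷ _)  (here refl) (there b∈)  e = ⊥-elim (All.lookup u (∈-map⁺ f b∈) e)
  unique-map⇒injective f (u ∷ _)  (there a∈)  (here refl) e = ⊥-elim (All.lookup u (∈-map⁺ f a∈) (sym e))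
  unique-map⇒injective f (_ ∷ us) (there a∈)  (there b∈)  e = unique-map⇒injective f us a∈ b∈ e

  Precedes : A → A → List A → Set
  Precedes a b xs = ∃₂ λ ys zs → xs ≡ ys ++ a ∷ zs × b ∈ zs

  precedes⇒∈ˡ : ∀ {a b xs} → Precedes a b xs → a ∈ xs
  precedes⇒∈ˡ (ys , zs , refl , _) = ∈-insert ys

  precedes⇒∈ʳ : ∀ {a b xs} → Precedes a b xs → b ∈ xs
  precedes⇒∈ʳ (ys , zs , refl , b∈) = ∈-++⁺ʳ ys (there b∈)

  precedes⇒≢ : ∀ {a b xs} → Unique xs → Precedes a b xs → a ≢ b
  precedes⇒≢ u (ys , zs , refl , b∈) refl = Unique.Unique[x∷xs]⇒x∉xs (unique-++⁻ʳ ys u) b∈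

  precedes-++⁻ : ∀ {a b} xs ys → Precedes a b (xs ++ ys) →
                 Precedes a b xs ⊎ (a ∈ xs × b ∈ ys) ⊎ Precedes a b ys
  precedes-++⁻ {a} {b} xs ys (ws , zs , eq , b∈) with ++-≡-++⁻ xs ys ws (a ∷ zs) eq
  ... | inj₁ (ks , _ , e₂)           = inj₂ (inj₂ (ks , zs , e₂ , b∈))
  ... | inj₂ ([] , _ , e₂)           = inj₂ (inj₂ ([] , zs , sym e₂ , b∈))
  ... | inj₂ (a′ ∷ ks , e₁ , e₂) with List.∷-injective e₂
  ... | refl , refl with ∈-++⁻ ks b∈
  ... | inj₁ b∈ks = inj₁ (ws , ks , e₁ , b∈ks)
  ... | inj₂ b∈ys = inj₂ (inj₁ (subst (a ∈_) (sym e₁) (∈-insert ws) , b∈ys))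

  precedes-++⁺ˡ : ∀ {a b} xs ys → Precedes a b xs → Precedes a b (xs ++ ys)
  precedes-++⁺ˡ xs ys (ws , zs , refl , b∈) = ws , zs ++ ys , List.++-assoc ws (_ ∷ zs) ys , ∈-++⁺ˡ b∈

  precedes-++⁺ʳ : ∀ {a b} xs ys → Precedes a b ys → Precedes a b (xs ++ ys)
  precedes-++⁺ʳ xs ys (ws , zs , refl , b∈) = xs ++ ws , zs , sym (List.++-assoc xs ws (_ ∷ zs)) , b∈

  precedes-++⁺ : ∀ {a b} xs ys → a ∈ xs → b ∈ ys → Precedes a b (xs ++ ys)
  precedes-++⁺ xs ys a∈ b∈ with ∈-∃++ a∈
  ... | ws , zs , refl = ws , zs ++ ys , List.++-assoc ws (_ ∷ zs) ys , ∈-++⁺ʳ zs b∈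

  precedes-∷⁻ : ∀ {a b x xs} → a ≢ x → Precedes a b (x ∷ xs) → Precedes a b xs
  precedes-∷⁻ a≢x ([]     , zs , refl , _)  = ⊥-elim (a≢x refl)
  precedes-∷⁻ a≢x (_ ∷ ys , zs , eq , b∈) = ys , zs , List.∷-injectiveʳ eq , b∈

  unique⇒¬precedes-head : ∀ {x y xs} → Unique (x ∷ xs) → ¬ Precedes y x (x ∷ xs)
  unique⇒¬precedes-head (x∉ ∷ _) ([]     , zs , refl , x∈) = All.lookup x∉ x∈ refl
  unique⇒¬precedes-head (x∉ ∷ _) (_ ∷ ys , zs , eq , x∈)   with List.∷-injective eq
  ... | refl , refl = All.lookup x∉ (∈-++⁺ʳ ys (there x∈)) refl

  precedes⇒index-< : ∀ {a b xs} → Unique xs → Precedes a b xs → (a∈ : a ∈ xs) (b∈ : b ∈ xs) →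
                     toℕ (Any.index a∈) < toℕ (Any.index b∈)
  precedes⇒index-< {a} {b} u (ys , zs , refl , b∈zs) a∈ b∈ =
    subst₂ _<_ (sym (index≡ a∈ (∈-insert ys))) (sym (index≡ b∈ (∈-++⁺ʳ ys (there b∈zs))))
      (subst₂ _<_ (sym (toℕ-index-++⁺ʳ ys (here refl))) (sym (toℕ-index-++⁺ʳ ys (there b∈zs)))
        (ℕ.+-monoʳ-< (length ys) (s≤s z≤n)))
    where
      index≡ : ∀ {c} (m m′ : c ∈ ys ++ a ∷ zs) → toℕ (Any.index m) ≡ toℕ (Any.index m′)
      index≡ m m′ = cong toℕ (unique-lookup-index u m (Any.index m′) (sym (lookup-index m′)))
      toℕ-index-++⁺ʳ : ∀ ws {vs c} (m : c ∈ vs) → toℕ (Any.index (∈-++⁺ʳ ws m)) ≡ length ws + toℕ (Any.index m)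
      toℕ-index-++⁺ʳ []       m = refl
      toℕ-index-++⁺ʳ (_ ∷ ws) m = cong suc (toℕ-index-++⁺ʳ ws m)

¬¬-Π-Fin : ∀ m {P : Fin m → Set} → (∀ i → ¬ ¬ P i) → ¬ ¬ (∀ i → P i)
¬¬-Π-Fin zero    h k = k (λ ())
¬¬-Π-Fin (suc m) h k = h fz (λ p₀ → ¬¬-Π-Fin m (λ i → h (fs i)) (λ ps → k (λ { fz → p₀ ; (fs i) → ps i })))

private
  indicator : ∀ {P : Set} → Dec P → ℕ
  indicator (yes _) = 1
  indicator (no _)  = 0

  indicator-mono : ∀ {P Q : Set} (P? : Dec P) (Q? : Dec Q) → (P → Q) → indicator P? ≤ indicator Q?
  indicator-mono (yes p) (yes q) f = ℕ.≤-refl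
  indicator-mono (yes p) (no ¬q) f = ⊥-elim (¬q (f p))
  indicator-mono (no _)  _       f = z≤n

count : ∀ {m} (P : Fin m → Set) → (∀ i → Dec (P i)) → ℕ
count {zero}  P P? = 0
count {suc m} P P? = indicator (P? fz) + count (λ i → P (fs i)) (λ i → P? (fs i))

count-mono : ∀ {m} (P Q : Fin m → Set) P? Q? → (∀ i → P i → Q i) → count P P? ≤ count Q Q?
count-mono {zero}  P Q P? Q? f = z≤n
count-mono {suc m} P Q P? Q? f =
  ℕ.+-mono-≤ (indicator-mono (P? fz) (Q? fz) (f fz)) (count-mono _ _ (λ i → P? (fs i)) (λ i → Q? (fs i)) (λ i → f (fs i)))

count-mono-< : ∀ {m} (P Q : Fin m → Set) P? Q? → (∀ i → P i → Q i) → ∀ k → Q k → ¬ P k → count P P? < count Q Q?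
count-mono-< {suc m} P Q P? Q? f fz q ¬p with P? fz | Q? fz
... | yes p | _      = ⊥-elim (¬p p)
... | no _  | no ¬q  = ⊥-elim (¬q q)
... | no _  | yes _  = s≤s (count-mono _ _ (λ i → P? (fs i)) (λ i → Q? (fs i)) (λ i → f (fs i)))
count-mono-< {suc m} P Q P? Q? f (fs k) q ¬p =
  ℕ.+-mono-≤-< (indicator-mono (P? fz) (Q? fz) (f fz))
               (count-mono-< _ _ (λ i → P? (fs i)) (λ i → Q? (fs i)) (λ i → f (fs i)) k q ¬p)

count-≤-size : ∀ {m} P P? → count {m} P P? ≤ m
count-≤-size {zero}  P P? = z≤n
count-≤-size {suc m} P P? with P? fz
... | yes _ = s≤s (count-≤-size _ _)
... | no _  = ℕ.m≤n⇒m≤1+n (count-≤-size _ _)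

count-positive : ∀ {m} (P : Fin m → Set) P? k → P k → 0 < count P P?
count-positive {suc m} P P? fz p with P? fz
... | yes _ = s≤s z≤n
... | no ¬p = ⊥-elim (¬p p)
count-positive {suc m} P P? (fs k) p =
  ℕ.<-≤-trans (count-positive _ (λ i → P? (fs i)) k p) (ℕ.m≤n+m _ (indicator (P? fz)))

module Trails (D : MultiDigraph) where

  open import Data.List.Membership.DecPropositional (_≟_ {MultiDigraph.nV D}) using (_∈?_)

  Vertex Arc : Set
  Vertex = V D
  Arc    = E D

  tail head : Arc → Vertex
  tail = src D
  head = tgt D

  Walk : Vertex → List Arc → Vertex → Set
  Walk = IsWalk D

  walk-++⁺ : ∀ {u v w xs ys} → Walk u xs v → Walk v ys w → Walk u (xs ++ ys) w
  walk-++⁺ nil        q = q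
  walk-++⁺ (cons e p) q = cons e (walk-++⁺ p q)

  walk-++⁻ : ∀ xs {ys u w} → Walk u (xs ++ ys) w → ∃[ v ] (Walk u xs v × Walk v ys w)
  walk-++⁻ []       p = _ , nil , p
  walk-++⁻ (a ∷ xs) (cons e p) with walk-++⁻ xs p
  ... | v , p₁ , p₂ = v , cons e p₁ , p₂

  walk-end-unique : ∀ {u es w w′} → Walk u es w → Walk u es w′ → w ≡ w′
  walk-end-unique nil        nil        = refl
  walk-end-unique (cons _ p) (cons _ q) = walk-end-unique p q

  walk-drop-prefix : ∀ {u xs ys v w} → Walk u xs v → Walk u (xs ++ ys) w → Walk v ys w
  walk-drop-prefix {xs = xs} wxs wxsys with walk-++⁻ xs wxsys
  ... | _ , wxs′ , wys = subst (λ v → Walk v _ _) (walk-end-unique wxs′ wxs) wys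

  walk-last-head : ∀ {v w} xs {a} → Walk v (xs ∷ʳ a) w → head a ≡ w
  walk-last-head xs w with walk-++⁻ xs w
  ... | _ , _ , cons _ nil = refl

  walk-vertSeq : ∀ {u es w} → Walk u es w → vertSeq D u es ≡ map tail es ∷ʳ w
  walk-vertSeq nil                      = refl
  walk-vertSeq (cons {a = a} refl p) = cong (tail a ∷_) (walk-vertSeq p)

  walk-end∈vertSeq : ∀ {u es w} → Walk u es w → w ∈ vertSeq D u es
  walk-end∈vertSeq {es = es} p rewrite walk-vertSeq p = ∈-++⁺ʳ (map tail es) (here refl)

  walk-vertSeq-++ : ∀ {u xs v} ys → Walk u xs v → vertSeq D u (xs ++ ys) ≡ map tail xs ++ v ∷ map head ys
  walk-vertSeq-++ {u} {xs} {v} ys p = begin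
    u ∷ map head (xs ++ ys)               ≡⟨ cong (u ∷_) (List.map-++ head xs ys) ⟩
    (u ∷ map head xs) ++ map head ys      ≡⟨ cong (_++ map head ys) (walk-vertSeq p) ⟩
    (map tail xs ∷ʳ v) ++ map head ys     ≡⟨ List.++-assoc (map tail xs) [ v ] (map head ys) ⟩
    map tail xs ++ v ∷ map head ys        ∎
    where open ≡-Reasoning

  vertSeq-++⁺ˡ : ∀ u xs ys {v} → v ∈ vertSeq D u xs → v ∈ vertSeq D u (xs ++ ys)
  vertSeq-++⁺ˡ u xs ys (here e)  = here e
  vertSeq-++⁺ˡ u xs ys (there m) rewrite List.map-++ head xs ys = there (∈-++⁺ˡ m)

  tails⊆vertSeq : ∀ {u es w} → Walk u es w → ∀ {v} → v ∈ map tail es → v ∈ vertSeq D u es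
  tails⊆vertSeq {es = es} p m rewrite walk-vertSeq p = ∈-++⁺ˡ m

  closedWalk-vertSeq⊆tails : ∀ {u es} → Walk u es u → es ≢ [] → ∀ {v} → v ∈ vertSeq D u es → v ∈ map tail es
  closedWalk-vertSeq⊆tails {u} {[]}     p es≢[] m = ⊥-elim (es≢[] refl)
  closedWalk-vertSeq⊆tails {u} {a ∷ es} p es≢[] m rewrite walk-vertSeq p with ∈-++⁻ (map tail (a ∷ es)) m
  ... | inj₁ m′          = m′
  ... | inj₂ (here refl) with p
  ... | cons e _ = here (sym e)

  -- Cycle sequences

  indexOf-∉ : ∀ {x} xs → x ∉ xs → indexOf D x xs ≡ nothing
  indexOf-∉ []       x∉ = refl
  indexOf-∉ {x} (y ∷ xs) x∉ with x ≟ y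
  ... | yes e = ⊥-elim (x∉ (here e))
  ... | no _  rewrite indexOf-∉ xs (λ m → x∉ (there m)) = refl

  indexOf-first : ∀ {x} xs {ys} → x ∉ xs → indexOf D x (xs ++ x ∷ ys) ≡ just (length xs)
  indexOf-first {x} [] x∉ with x ≟ x
  ... | yes _ = refl
  ... | no x≢x = ⊥-elim (x≢x refl)
  indexOf-first {x} (y ∷ xs) {ys} x∉ with x ≟ y
  ... | yes e = ⊥-elim (x∉ (here e))
  ... | no _  rewrite indexOf-first xs {ys} (λ m → x∉ (there m)) = refl

  firstRepeatAux-++ : ∀ seen t ys {x zs i} → Unique (seen ++ ys) → indexOf D x (seen ++ ys) ≡ just i →
                      firstRepeatAux D seen t (ys ++ x ∷ zs) ≡ just (i , t + length ys)
  firstRepeatAux-++ seen t []       u eq rewrite List.++-identityʳ seen | eq | ℕ.+-identityʳ t = refl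
  firstRepeatAux-++ seen t (y ∷ ys) {x} {zs} {i} u eq
    rewrite indexOf-∉ seen (unique-middle⇒∉prefix seen u)
          | firstRepeatAux-++ (seen ∷ʳ y) (suc t) ys {x} {zs} {i}
              (subst Unique (sym (List.++-assoc seen [ y ] ys)) u)
              (trans (cong (indexOf D x) (List.++-assoc seen [ y ] ys)) eq)
          | ℕ.+-suc t (length ys) = refl

  firstRepeat-++ : ∀ xs {x ys i} → Unique xs → indexOf D x xs ≡ just i →
                   firstRepeat D (xs ++ x ∷ ys) ≡ just (i , length xs)
  firstRepeat-++ []       _ ()
  firstRepeat-++ (y ∷ xs) u eq = firstRepeatAux-++ [ y ] 1 xs u eq

  -- Along the closed walk p ++ c ++ r at u, c is the first cycle to close: it
  -- closes at x, and no vertex repeats before.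
  record FirstCycle (u : Vertex) (p c r : List Arc) (x : Vertex) : Set where
    constructor firstCycle
    field
      prefix       : Walk u p x
      cycle        : Walk x c x
      suffix       : Walk x r u
      c≢[]         : c ≢ []
      tails-unique : Unique (map tail (p ++ c))

    remainder : Walk u (p ++ r) u
    remainder = walk-++⁺ prefix suffix

  firstRepeat-firstCycle : ∀ {u p c r x} → FirstCycle u p c r x →
    firstRepeat D (vertSeq D u (p ++ c ++ r)) ≡ just (length p , length p + length c)
  firstRepeat-firstCycle {c = []}    fc = ⊥-elim (FirstCycle.c≢[] fc refl)
  firstRepeat-firstCycle {u} {p} {a ∷ c} {r} {x} (firstCycle wp wc@(cons refl _) wr _ uniq) =
    subst (λ vs → firstRepeat D vs ≡ just (length p , length p + length (a ∷ c))) (sym vertSeq≡)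
      (trans (firstRepeat-++ (map tail p ++ x ∷ map tail c) uniq′ index) (cong (λ n → just (length p , n)) length≡))
    where
      tails≡ : map tail (p ++ a ∷ c) ≡ map tail p ++ x ∷ map tail c
      tails≡ = List.map-++ tail p (a ∷ c)
      uniq′ : Unique (map tail p ++ x ∷ map tail c)
      uniq′ = subst Unique tails≡ uniq
      vertSeq≡ : vertSeq D u (p ++ (a ∷ c) ++ r) ≡ (map tail p ++ x ∷ map tail c) ++ x ∷ map head r
      vertSeq≡ = begin
        vertSeq D u (p ++ (a ∷ c) ++ r)                 ≡⟨ cong (vertSeq D u) (sym (List.++-assoc p (a ∷ c) r)) ⟩
        vertSeq D u ((p ++ a ∷ c) ++ r)                 ≡⟨ walk-vertSeq-++ r (walk-++⁺ wp wc) ⟩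
        map tail (p ++ a ∷ c) ++ x ∷ map head r         ≡⟨ cong (_++ x ∷ map head r) tails≡ ⟩
        (map tail p ++ x ∷ map tail c) ++ x ∷ map head r ∎
        where open ≡-Reasoning
      index : indexOf D x (map tail p ++ x ∷ map tail c) ≡ just (length p)
      index = trans (indexOf-first (map tail p) (unique-middle⇒∉prefix (map tail p) uniq′))
                    (cong just (List.length-map tail p))
      length≡ : length (map tail p ++ x ∷ map tail c) ≡ length p + length (a ∷ c)
      length≡ = trans (List.length-++ (map tail p))
                      (cong₂ _+_ (List.length-map tail p) (cong suc (List.length-map tail c)))

  csAux-firstCycle : ∀ n {u p c r x} → FirstCycle u p c r x →
    csAux D (suc n) u (p ++ c ++ r) ≡ (x , c) ∷ csAux D n u (p ++ r)
  csAux-firstCycle n {u} {p} {c} {r} {x} fc rewrite firstRepeat-firstCycle fc =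
    cong₂ _∷_ (cong₂ _,_ start≡ cycle≡) (cong (csAux D n u) remainder≡)
    where
      start≡ : fromMaybe u (Data.List.head (drop (length p) (vertSeq D u (p ++ c ++ r)))) ≡ x
      start≡ rewrite walk-vertSeq-++ (c ++ r) (FirstCycle.prefix fc)
                   | sym (List.length-map tail p)
                   | drop-length-++ (map tail p) (x ∷ map head (c ++ r)) = refl
      cycle≡ : drop (length p) (take (length p + length c) (p ++ c ++ r)) ≡ c
      cycle≡ rewrite take-length-+-++ p (length c) (c ++ r)
                   | drop-length-++ p (take (length c) (c ++ r)) = take-length-++ c r
      remainder≡ : take (length p) (p ++ c ++ r) ++ drop (length p + length c) (p ++ c ++ r) ≡ p ++ r
      remainder≡ rewrite take-length-++ p (c ++ r)
                       | drop-length-+-++ p (length c) (c ++ r)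
                       | drop-length-++ c r = refl

  FirstCycleOf : Vertex → List Arc → Set
  FirstCycleOf u es = ∃ λ p → ∃ λ c → ∃ λ r → ∃ λ x → es ≡ p ++ c ++ r × FirstCycle u p c r x

  private
    tail∈tails : ∀ {u a as w} → Walk u (a ∷ as) w → u ∈ map tail (a ∷ as)
    tail∈tails (cons e _) = here (sym e)

  -- Walk along es keeping the walked part pre, until the current vertex y is
  -- already the tail of an arc of pre.
  firstCycle-search : ∀ pre es {u y} → pre ≢ [] → Walk u pre y → Walk y es u → Unique (map tail pre) →
                      FirstCycleOf u (pre ++ es)
  firstCycle-search pre es {u} {y} pre≢[] wpre wes uniq with y ∈? map tail pre
  ... | yes y∈ with ∈-∃++ y∈
  ...   | as₁ , as₂ , eq with map-≡-++⁻ tail pre as₁ (y ∷ as₂) eq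
  ...     | p , [] , refl , _ , ()
  ...     | p , a ∷ c , refl , _ , tails-c with walk-++⁻ p wpre
  ...       | x , wp , wc@(cons refl _) with List.∷-injective tails-c
  ...         | refl , _ = p , a ∷ c , es , y , List.++-assoc p (a ∷ c) es , firstCycle wp wc wes (λ ()) uniq
  firstCycle-search (a ∷ pre) [] _      wpre nil _ | no y∉ = ⊥-elim (y∉ (tail∈tails wpre))
  firstCycle-search []        [] pre≢[] _    _   _ | no _  = ⊥-elim (pre≢[] refl)
  firstCycle-search pre (a ∷ es) {u} {y} pre≢[] wpre (cons e wes) uniq | no y∉
    with firstCycle-search (pre ∷ʳ a) es (∷ʳ≢[] pre) (walk-++⁺ wpre (cons e nil)) wes uniq′
    where
      uniq′ : Unique (map tail (pre ∷ʳ a))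
      uniq′ rewrite List.map-++ tail pre [ a ] =
        unique-++⁺ uniq ([] ∷ []) (λ { m (here refl) → y∉ (subst (_∈ map tail pre) e m) })
  ... | p , c , r , x , eq , fc = p , c , r , x , trans (sym (List.++-assoc pre [ a ] es)) eq , fc

  firstCycle-exists : ∀ {u es} → Walk u es u → es ≢ [] → FirstCycleOf u es
  firstCycle-exists {es = []}     w      es≢[] = ⊥-elim (es≢[] refl)
  firstCycle-exists {es = a ∷ es} (cons e w) _ = firstCycle-search [ a ] es (λ ()) (cons e nil) w ([] ∷ [])

  data CycleSeq (u : Vertex) : List Arc → List (Cyc D) → Set where
    []   : CycleSeq u [] []
    peel : ∀ {p c r x βs} → FirstCycle u p c r x → CycleSeq u (p ++ r) βs → CycleSeq u (p ++ c ++ r) ((x , c) ∷ βs)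

  private
    length-remainder-< : ∀ (p c r : List Arc) → c ≢ [] → length (p ++ r) < length (p ++ c ++ r)
    length-remainder-< []      []      r c≢[] = ⊥-elim (c≢[] refl)
    length-remainder-< []      (a ∷ c) r _    =
      s≤s (subst (length r ≤_) (sym (List.length-++ c)) (ℕ.m≤n+m (length r) (length c)))
    length-remainder-< (a ∷ p) c       r c≢[] = s≤s (length-remainder-< p c r c≢[])

    csAux-cycleSeq : ∀ n {u} es → length es ≤ n → Walk u es u → CycleSeq u es (csAux D n u es)
    csAux-cycleSeq zero    []       _ _ = []
    csAux-cycleSeq (suc n) []       _ _ = []
    csAux-cycleSeq (suc n) {u} (a ∷ es) es≤ w with firstCycle-exists w (λ ())
    ... | p , c , r , x , eq , fc =
      subst (λ ws → CycleSeq u ws (csAux D (suc n) u ws)) (sym eq)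
        (subst (CycleSeq u (p ++ c ++ r)) (sym (csAux-firstCycle n fc))
          (peel fc (csAux-cycleSeq n (p ++ r) remainder≤ (FirstCycle.remainder fc))))
      where
        remainder≤ : length (p ++ r) ≤ n
        remainder≤ = ℕ.≤-pred (ℕ.≤-trans (length-remainder-< p c r (FirstCycle.c≢[] fc))
                                          (subst (λ ws → length ws ≤ suc n) eq es≤))

    cycleSeq⇒csAux : ∀ {u es βs} → CycleSeq u es βs → ∀ n → length es ≤ n → csAux D n u es ≡ βs
    cycleSeq⇒csAux []         zero    _   = refl
    cycleSeq⇒csAux []         (suc n) _   = refl
    cycleSeq⇒csAux (peel {p} {c} {r} fc βs) zero es≤ =
      ⊥-elim (ℕ.<⇒≱ (length-remainder-< p c r (FirstCycle.c≢[] fc)) (ℕ.≤-trans es≤ z≤n))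
    cycleSeq⇒csAux (peel {p} {c} {r} {x} fc βs) (suc n) es≤ =
      trans (csAux-firstCycle n fc)
            (cong ((x , c) ∷_) (cycleSeq⇒csAux βs n
              (ℕ.≤-pred (ℕ.≤-trans (length-remainder-< p c r (FirstCycle.c≢[] fc)) es≤))))

  cs-cycleSeq : ∀ {u es} → Walk u es u → CycleSeq u es (cs D u es)
  cs-cycleSeq {es = es} w = csAux-cycleSeq (length es) es ℕ.≤-refl w

  cycleSeq⇒cs : ∀ {u es βs} → CycleSeq u es βs → cs D u es ≡ βs
  cycleSeq⇒cs {es = es} βs = cycleSeq⇒csAux βs (length es) ℕ.≤-refl

  -- The heap of a closed trail

  concurrent-sym : ∀ {β γ} → Concurrent D β γ → Concurrent D γ β
  concurrent-sym (v , m₁ , m₂) = v , m₂ , m₁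

  concurrent? : ∀ β γ → Dec (Concurrent D β γ)
  concurrent? β γ with Any.any? (_∈? cycVerts D γ) (cycVerts D β)
  ... | yes v∈ = yes (find v∈)
  ... | no ∉   = no (λ (v , m₁ , m₂) → ∉ (Any.map (λ e → subst (_∈ cycVerts D γ) e m₂) m₁))

  HeapStep : (βs : List (Cyc D)) → Fin (length βs) → Fin (length βs) → Set
  HeapStep βs i j = toℕ i < toℕ j × Concurrent D (lookup βs i) (lookup βs j)

  HeapOrder : (βs : List (Cyc D)) → Fin (length βs) → Fin (length βs) → Set
  HeapOrder βs = Star (HeapStep βs)

  heapOrder⇒toℕ-≤ : ∀ βs {i j} → HeapOrder βs i j → toℕ i ≤ toℕ j
  heapOrder⇒toℕ-≤ βs ε          = ℕ.≤-refl
  heapOrder⇒toℕ-≤ βs (st ◅ sts) = ℕ.≤-trans (ℕ.<⇒≤ (proj₁ st)) (heapOrder⇒toℕ-≤ βs sts)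

  heapOrder-antisym : ∀ βs i j → HeapOrder βs i j → HeapOrder βs j i → i ≡ j
  heapOrder-antisym βs i j p q = Fin.toℕ-injective (ℕ.≤-antisym (heapOrder⇒toℕ-≤ βs p) (heapOrder⇒toℕ-≤ βs q))

  heapOrder-∷ : ∀ β βs {i j} → HeapOrder βs i j → HeapOrder (β ∷ βs) (fs i) (fs j)
  heapOrder-∷ β βs = Star.gmap fs (λ (lt , cc) → s≤s lt , cc)

  heapOf-isHeap : ∀ βs → (∀ i → IsCycle D (lookup βs i)) → IsHeap D (heapOf D βs)
  heapOf-isHeap βs βs-cycles = record
    { refl′     = λ _ → ε
    ; antisym   = heapOrder-antisym βs
    ; trans′    = λ _ _ _ → _◅◅_
    ; labelsCyc = βs-cycles
    ; concComp  = comparable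
    ; coverConc = cover-concurrent
    }
    where
      comparable : ∀ i j → Concurrent D (lookup βs i) (lookup βs j) → HeapOrder βs i j ⊎ HeapOrder βs j i
      comparable i j cc with ℕ.<-cmp (toℕ i) (toℕ j)
      ... | tri< i<j _ _ = inj₁ ((i<j , cc) ◅ ε)
      ... | tri≈ _ i≡j _ = inj₁ (subst (HeapOrder βs i) (Fin.toℕ-injective i≡j) ε)
      ... | tri> _ _ j<i = inj₂ ((j<i , concurrent-sym cc) ◅ ε)
      -- a covering pair is a single step, and steps join concurrent pieces
      cover-concurrent : ∀ i j → Covers D (heapOf D βs) i j → Concurrent D (lookup βs i) (lookup βs j)
      cover-concurrent i j ((ε , i≢j) , _) = ⊥-elim (i≢j refl)
      cover-concurrent i j ((_◅_ {j = k} st sts , _) , nothing-between) with k ≟ j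
      ... | yes refl = proj₂ st
      ... | no k≢j   = ⊥-elim (nothing-between k ((st ◅ ε , λ e → ℕ.<⇒≢ (proj₁ st) (cong toℕ e)) , (sts , k≢j)))

  arcsOf : List (Cyc D) → List Arc
  arcsOf βs = concat (map (cycArcs D) βs)

  cycleSeq-↭ : ∀ {u es βs} → CycleSeq u es βs → es ↭ arcsOf βs
  cycleSeq-↭ []                        = ↭-refl
  cycleSeq-↭ (peel {p} {c} {r} fc βs) = ↭-trans (Perm.shifts p c) (Perm.++⁺ˡ c (cycleSeq-↭ βs))

  ∈-arcsOf⁻ : ∀ βs {a} → a ∈ arcsOf βs → ∃[ i ] a ∈ cycArcs D (lookup βs i)
  ∈-arcsOf⁻ ((x , c) ∷ βs) m with ∈-++⁻ c m
  ... | inj₁ m′ = fz , m′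
  ... | inj₂ m′ with ∈-arcsOf⁻ βs m′
  ... | i , m″ = fs i , m″

  ∈-arcsOf⁺ : ∀ βs {a} i → a ∈ cycArcs D (lookup βs i) → a ∈ arcsOf βs
  ∈-arcsOf⁺ ((x , c) ∷ βs) fz     m = ∈-++⁺ˡ m
  ∈-arcsOf⁺ ((x , c) ∷ βs) (fs i) m = ∈-++⁺ʳ c (∈-arcsOf⁺ βs i m)

  unique-arcsOf⇒disjoint : ∀ βs {a} i j → Unique (arcsOf βs) →
    a ∈ cycArcs D (lookup βs i) → a ∈ cycArcs D (lookup βs j) → i ≡ j
  unique-arcsOf⇒disjoint ((x , c) ∷ βs) fz     fz     u m₁ m₂ = refl
  unique-arcsOf⇒disjoint ((x , c) ∷ βs) fz     (fs j) u m₁ m₂ = ⊥-elim (unique-++⇒disjoint c u m₁ (∈-arcsOf⁺ βs j m₂))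
  unique-arcsOf⇒disjoint ((x , c) ∷ βs) (fs i) fz     u m₁ m₂ = ⊥-elim (unique-++⇒disjoint c u m₂ (∈-arcsOf⁺ βs i m₁))
  unique-arcsOf⇒disjoint ((x , c) ∷ βs) (fs i) (fs j) u m₁ m₂ =
    cong fs (unique-arcsOf⇒disjoint βs i j (unique-++⁻ʳ c u) m₁ m₂)

  closedWalk-heads↭tails : ∀ {x c} → Walk x c x → map head c ↭ map tail c
  closedWalk-heads↭tails {x} {c} w =
    Perm.drop-∷ (↭-trans (↭-reflexive (walk-vertSeq w)) (↭-sym (Perm.∷↭∷ʳ x (map tail c))))

  unique-remainder : ∀ (p c r : List Arc) → Unique (p ++ c ++ r) → Unique (p ++ r)
  unique-remainder p c r u = unique-++⁻ʳ c (unique-resp-↭ (Perm.shifts p c) u)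

  firstCycle-isCycle : ∀ {u p c r x} → FirstCycle u p c r x → Unique (p ++ c ++ r) → IsCycle D (x , c)
  firstCycle-isCycle {p = p} {c} {r} (firstCycle _ wc _ c≢[] uniq) u =
    (wc , unique-++⁻ˡ c (unique-++⁻ʳ p u)) , c≢[] ,
    unique-resp-↭ (↭-sym (closedWalk-heads↭tails wc))
                  (unique-++⁻ʳ (map tail p) (subst Unique (List.map-++ tail p c) uniq))

  cycleSeq-isCycle : ∀ {u es βs} → CycleSeq u es βs → Unique es → ∀ i → IsCycle D (lookup βs i)
  cycleSeq-isCycle (peel fc βs)             u fz     = firstCycle-isCycle fc u
  cycleSeq-isCycle (peel {p} {c} {r} fc βs) u (fs i) = cycleSeq-isCycle βs (unique-remainder p c r u) i

  private
    vertSeq-middle⁻ : ∀ u (p c r : List Arc) {v} → v ∈ vertSeq D u (p ++ c ++ r) → v ∈ map head c ⊎ v ∈ vertSeq D u (p ++ r)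
    vertSeq-middle⁻ u p c r (here e) = inj₂ (here e)
    vertSeq-middle⁻ u p c r (there m) rewrite List.map-++ head p (c ++ r) | List.map-++ head c r | List.map-++ head p r
      with ∈-++⁻ (map head p) m
    ... | inj₁ m₁ = inj₂ (there (∈-++⁺ˡ m₁))
    ... | inj₂ m₂ with ∈-++⁻ (map head c) m₂
    ... | inj₁ m₃ = inj₁ m₃
    ... | inj₂ m₄ = inj₂ (there (∈-++⁺ʳ (map head p) m₄))

  cycleSeq-vertex⇒piece : ∀ {u es βs} → CycleSeq u es βs → es ≢ [] →
                          ∀ {v} → v ∈ vertSeq D u es → ∃[ j ] v ∈ cycVerts D (lookup βs j)
  cycleSeq-vertex⇒piece [] es≢[] m = ⊥-elim (es≢[] refl)
  cycleSeq-vertex⇒piece (peel {p} {c} {r} fc βs) es≢[] m with vertSeq-middle⁻ _ p c r m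
  ... | inj₁ m₁ = fz , there m₁
  cycleSeq-vertex⇒piece (peel {[]} {c} {[]} (firstCycle nil _ _ _ _) βs) _ m | inj₂ (here refl) = fz , here refl
  cycleSeq-vertex⇒piece (peel {[]} {c} {a ∷ r} fc βs) _ m | inj₂ m₂ with cycleSeq-vertex⇒piece βs (λ ()) m₂
  ... | j , m′ = fs j , m′
  cycleSeq-vertex⇒piece (peel {a ∷ p} fc βs) _ m | inj₂ m₂ with cycleSeq-vertex⇒piece βs (λ ()) m₂
  ... | j , m′ = fs j , m′

  record Apex (u : Vertex) (es : List Arc) (βs : List (Cyc D)) : Set where
    field
      apex       : Fin (length βs)
      below-apex : ∀ i → HeapOrder βs i apex
      start∈apex : u ∈ cycVerts D (lookup βs apex)
      last∈apex  : ∀ xs a → es ≡ xs ∷ʳ a → a ∈ cycArcs D (lookup βs apex)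

  private
    firstCycle-closing⇒prefix-[] : ∀ {u p c x} → FirstCycle u p c [] x → p ≡ []
    firstCycle-closing⇒prefix-[] {p = []} _ = refl
    firstCycle-closing⇒prefix-[] {p = a ∷ p} {[]} fc = ⊥-elim (FirstCycle.c≢[] fc refl)
    firstCycle-closing⇒prefix-[] {p = a ∷ p} {b ∷ c} (firstCycle (cons ta≡u _) (cons tb≡u _) nil _ (ta∉ ∷ _)) =
      ⊥-elim (All.lookup ta∉ (subst (tail b ∈_) (sym (List.map-++ tail p (b ∷ c))) (∈-++⁺ʳ (map tail p) (here refl)))
                         (trans ta≡u (sym tb≡u)))

    apex-peel : ∀ {u p c r x βs} → FirstCycle u p c r x → CycleSeq u (p ++ r) βs → p ++ r ≢ [] →
                Apex u (p ++ r) βs → Apex u (p ++ c ++ r) ((x , c) ∷ βs)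
    apex-peel {u} {p} {c} {r} {x} {βs} fc βs′ rem≢[] A = record
      { apex       = fs A.apex
      ; below-apex = below
      ; start∈apex = A.start∈apex
      ; last∈apex  = last∈
      }
      where
        module A = Apex A
        -- the new first cycle meets the remainder at x
        below : ∀ i → HeapOrder ((x , c) ∷ βs) i (fs A.apex)
        below fz with cycleSeq-vertex⇒piece βs′ rem≢[] (vertSeq-++⁺ˡ u p r (walk-end∈vertSeq (FirstCycle.prefix fc)))
        ... | j , x∈ = (s≤s z≤n , (x , here refl , x∈)) ◅ heapOrder-∷ (x , c) βs (A.below-apex j)
        below (fs i) = heapOrder-∷ (x , c) βs (A.below-apex i)
        last∈ : ∀ xs a → p ++ c ++ r ≡ xs ∷ʳ a → a ∈ cycArcs D (lookup ((x , c) ∷ βs) (fs A.apex))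
        last∈ xs a eq with initLast r
        ... | [] = ⊥-elim (rem≢[] (trans (List.++-identityʳ p) (firstCycle-closing⇒prefix-[] fc)))
        ... | rs ∷ʳ′ b with List.∷ʳ-injective (p ++ c ++ rs) xs
                              (trans (trans (List.++-assoc p (c ++ rs) [ b ]) (cong (p ++_) (List.++-assoc c rs [ b ]))) eq)
        ... | _ , refl = A.last∈apex (p ++ rs) b (sym (List.++-assoc p rs [ b ]))

  cycleSeq-[] : ∀ {u es βs} → CycleSeq u es βs → es ≡ [] → βs ≡ []
  cycleSeq-[] []                        _  = refl
  cycleSeq-[] (peel {p} {c} {r} fc βs) eq =
    ⊥-elim (FirstCycle.c≢[] fc (List.++-conicalˡ c r (List.++-conicalʳ p (c ++ r) eq)))

  cycleSeq-apex : ∀ {u es βs} → CycleSeq u es βs → es ≢ [] → Apex u es βs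
  cycleSeq-apex [] es≢[] = ⊥-elim (es≢[] refl)
  cycleSeq-apex (peel {[]} {c} {[]} (firstCycle nil _ _ _ _) βs) _ rewrite cycleSeq-[] βs refl = record
    { apex       = fz
    ; below-apex = λ { fz → ε }
    ; start∈apex = here refl
    ; last∈apex  = λ xs a eq → subst (a ∈_) (trans (sym eq) (List.++-identityʳ c)) (∈-++⁺ʳ xs (here refl))
    }
  cycleSeq-apex (peel {[]}    {r = a ∷ r} fc βs) _ = apex-peel fc βs (λ ()) (cycleSeq-apex βs (λ ()))
  cycleSeq-apex (peel {a ∷ p}             fc βs) _ = apex-peel fc βs (λ ()) (cycleSeq-apex βs (λ ()))

  g-decompPyramid : ∀ {u es} (P : Cyc D → Set) → IsEulerianTrail D u es → es ≢ [] →
                    (∀ (A : Apex u es (cs D u es)) → P (lookup (cs D u es) (Apex.apex A))) →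
                    IsDecompPyramidWith D (g D u es) P
  g-decompPyramid {u} {es} P ((w , uniq) , all∈) es≢[] apex-P =
    heapOf-isHeap βs (cycleSeq-isCycle seq uniq) , decomposition , A.apex , (maximal , unique-maximal) , apex-P A
    where
      βs  = cs D u es
      seq = cs-cycleSeq w
      A   = cycleSeq-apex seq es≢[]
      module A = Apex A
      decomposition : IsDecomposition D (g D u es)
      decomposition a =
        ∈-arcsOf⁻ βs (Perm.∈-resp-↭ (cycleSeq-↭ seq) (all∈ a)) ,
        λ i j → unique-arcsOf⇒disjoint βs i j (unique-resp-↭ (cycleSeq-↭ seq) uniq)
      maximal : IsMaximal D (g D u es) A.apex
      maximal j apex≤j = heapOrder-antisym βs j A.apex (A.below-apex j) apex≤j
      unique-maximal : ∀ i → IsMaximal D (g D u es) i → i ≡ A.apex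
      unique-maximal i i-maximal = sym (i-maximal A.apex (A.below-apex i))

  -- Injectivity

  private
    remainder-∉-cycle : ∀ (p c r : List Arc) {a} → Unique (p ++ c ++ r) → a ∈ p ++ r → a ∉ c
    remainder-∉-cycle p c r u a∈ a∈c = unique-++⇒disjoint c (unique-resp-↭ (Perm.shifts p c) u) a∈c a∈

    precedes-remainder : ∀ {a b} (p c r : List Arc) → a ∉ c → b ∉ c →
                         Precedes a b (p ++ c ++ r) → Precedes a b (p ++ r)
    precedes-remainder p c r a∉c b∉c prec with precedes-++⁻ p (c ++ r) prec
    ... | inj₁ prec-p = precedes-++⁺ˡ p r prec-p
    ... | inj₂ (inj₁ (a∈p , b∈cr)) with ∈-++⁻ c b∈cr
    ...   | inj₁ b∈c = ⊥-elim (b∉c b∈c)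
    ...   | inj₂ b∈r = precedes-++⁺ p r a∈p b∈r
    precedes-remainder p c r a∉c b∉c prec | inj₂ (inj₂ prec-cr) with precedes-++⁻ c r prec-cr
    ...   | inj₁ prec-c        = ⊥-elim (a∉c (precedes⇒∈ˡ prec-c))
    ...   | inj₂ (inj₁ (a∈c , _)) = ⊥-elim (a∉c a∈c)
    ...   | inj₂ (inj₂ prec-r) = precedes-++⁺ʳ p r prec-r

    later-piece-∉-cycle : ∀ (p c r : List Arc) {u δs} → CycleSeq u (p ++ r) δs → Unique (p ++ c ++ r) →
                          ∀ k {a} → a ∈ cycArcs D (lookup δs k) → a ∉ c
    later-piece-∉-cycle p c r {δs = δs} seq u k a∈ =
      remainder-∉-cycle p c r u (Perm.∈-resp-↭ (↭-sym (cycleSeq-↭ seq)) (∈-arcsOf⁺ δs k a∈))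

  -- Of two arcs leaving the same vertex, the one used first lies on a cycle
  -- that closes earlier: until that cycle is peeled off, the vertex cannot be
  -- left again.
  cycleSeq-precedes⇒< : ∀ {u es βs} → CycleSeq u es βs → Unique es → ∀ {a b} → Precedes a b es → tail a ≡ tail b →
                        ∀ i j → a ∈ cycArcs D (lookup βs i) → b ∈ cycArcs D (lookup βs j) → toℕ i < toℕ j
  cycleSeq-precedes⇒< (peel {p} {c} fc _) u prec same fz fz a∈ b∈ =
    ⊥-elim (precedes⇒≢ u prec (unique-map⇒injective tail tails-c a∈ b∈ same))
    where tails-c = unique-++⁻ʳ (map tail p) (subst Unique (List.map-++ tail p c) (FirstCycle.tails-unique fc))
  cycleSeq-precedes⇒< (peel fc _) u prec same fz (fs j) a∈ b∈ = s≤s z≤n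
  cycleSeq-precedes⇒< (peel {p} {c} {r} fc βs) u {a} {b} prec same (fs i) fz a∈ b∈
    with precedes-++⁻ p (c ++ r) prec
  ... | inj₁ prec-p = ⊥-elim (unique-++⇒disjoint p u (precedes⇒∈ʳ prec-p) (∈-++⁺ˡ b∈))
  ... | inj₂ (inj₁ (a∈p , _)) =
        ⊥-elim (unique-++⇒disjoint (map tail p) (subst Unique (List.map-++ tail p c) (FirstCycle.tails-unique fc))
                  (∈-map⁺ tail a∈p) (subst (_∈ map tail c) (sym same) (∈-map⁺ tail b∈)))
  ... | inj₂ (inj₂ prec-cr) with precedes-++⁻ c r prec-cr
  ...   | inj₁ prec-c           = ⊥-elim (later-piece-∉-cycle p c r βs u i a∈ (precedes⇒∈ˡ prec-c))
  ...   | inj₂ (inj₁ (a∈c , _)) = ⊥-elim (later-piece-∉-cycle p c r βs u i a∈ a∈c)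
  ...   | inj₂ (inj₂ prec-r)    = ⊥-elim (remainder-∉-cycle p c r u (∈-++⁺ʳ p (precedes⇒∈ʳ prec-r)) b∈)
  cycleSeq-precedes⇒< (peel {p} {c} {r} fc βs) u prec same (fs i) (fs j) a∈ b∈ =
    s≤s (cycleSeq-precedes⇒< βs (unique-remainder p c r u)
          (precedes-remainder p c r (later-piece-∉-cycle p c r βs u i a∈) (later-piece-∉-cycle p c r βs u j b∈) prec)
          same i j a∈ b∈)

  cycEq-∈ : ∀ {β γ a} → CycEq D β γ → a ∈ cycArcs D β → a ∈ cycArcs D γ
  cycEq-∈ {_ , _} {_ , _} (xs , ys , refl , refl) a∈ = Perm.∈-resp-↭ (Perm.++-comm xs ys) a∈

  cycle-tail∈cycVerts : ∀ {β a} → IsCycle D β → a ∈ cycArcs D β → tail a ∈ cycVerts D β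
  cycle-tail∈cycVerts ((w , _) , _) a∈ = tails⊆vertSeq w (∈-map⁺ tail a∈)

  heapIso-preserves-departures : ∀ {u es u′ es′} → IsClosedTrail D u es → IsClosedTrail D u′ es′ →
    HeapIso D (g D u es) (g D u′ es′) → ∀ {a b} → Precedes a b es → tail a ≡ tail b → ¬ Precedes b a es′
  heapIso-preserves-departures {u} {es} {u′} {es′} (w , uniq) (w′ , uniq′) iso {a} {b} prec same prec′ =
    ℕ.<⇒≱ to-j<to-i (heapOrder⇒toℕ-≤ γs (proj₁ (HeapIso.ordIso iso i j) ((i<j , concurrent) ◅ ε)))
    where
      βs  = cs D u es
      γs  = cs D u′ es′
      seq = cs-cycleSeq w
      to  = Inverse.to (HeapIso.σ iso)
      piece-of : ∀ {z} → z ∈ es → ∃[ k ] z ∈ cycArcs D (lookup βs k)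
      piece-of z∈ = ∈-arcsOf⁻ βs (Perm.∈-resp-↭ (cycleSeq-↭ seq) z∈)
      i = proj₁ (piece-of (precedes⇒∈ˡ prec))
      j = proj₁ (piece-of (precedes⇒∈ʳ prec))
      a∈i = proj₂ (piece-of (precedes⇒∈ˡ prec))
      b∈j = proj₂ (piece-of (precedes⇒∈ʳ prec))
      i<j : toℕ i < toℕ j
      i<j = cycleSeq-precedes⇒< seq uniq prec same i j a∈i b∈j
      concurrent : Concurrent D (lookup βs i) (lookup βs j)
      concurrent = tail a , cycle-tail∈cycVerts (cycleSeq-isCycle seq uniq i) a∈i ,
                   subst (_∈ cycVerts D (lookup βs j)) (sym same) (cycle-tail∈cycVerts (cycleSeq-isCycle seq uniq j) b∈j)
      to-j<to-i : toℕ (to j) < toℕ (to i)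
      to-j<to-i = cycleSeq-precedes⇒< (cs-cycleSeq w′) uniq′ prec′ (sym same) (to j) (to i)
                    (cycEq-∈ {lookup βs j} {lookup γs (to j)} (HeapIso.labelIso iso j) b∈j)
                    (cycEq-∈ {lookup βs i} {lookup γs (to i)} (HeapIso.labelIso iso i) a∈i)

  private
    -- At the first difference both trails leave the same vertex, in opposite orders.
    common-prefix-extends : ∀ {u es es′} → IsEulerianTrail D u es → IsEulerianTrail D u es′ →
      HeapIso D (g D u es) (g D u es′) → ∀ pre rs rs′ → es ≡ pre ++ rs → es′ ≡ pre ++ rs′ → rs ≡ rs′
    common-prefix-extends _ _ _ pre [] [] _ _ = refl
    common-prefix-extends E ((_ , uniq′) , _) _ pre [] (b ∷ rs′) refl refl =
      ⊥-elim (unique-middle⇒∉prefix pre uniq′ (subst (b ∈_) (List.++-identityʳ pre) (proj₂ E b)))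
    common-prefix-extends ((_ , uniq) , _) E′ _ pre (a ∷ rs) [] refl refl =
      ⊥-elim (unique-middle⇒∉prefix pre uniq (subst (a ∈_) (List.++-identityʳ pre) (proj₂ E′ a)))
    common-prefix-extends {u} E E′ iso pre (a ∷ rs) (b ∷ rs′) refl refl with a ≟ b
    ... | yes refl = cong (a ∷_) (common-prefix-extends E E′ iso (pre ∷ʳ a) rs rs′
                                    (sym (List.++-assoc pre [ a ] rs)) (sym (List.++-assoc pre [ a ] rs′)))
    ... | no a≢b = ⊥-elim (heapIso-preserves-departures (proj₁ E) (proj₁ E′) iso (pre , rs , refl , b∈rs) same-tail
                              (pre , rs′ , refl , a∈rs′))
      where
        after-prefix : ∀ {z y ys} → z ∈ pre ++ y ∷ ys → z ∉ pre → z ≢ y → z ∈ ys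
        after-prefix z∈ z∉pre z≢y with ∈-++⁻ pre z∈
        ... | inj₁ z∈pre        = ⊥-elim (z∉pre z∈pre)
        ... | inj₂ (here z≡y)   = ⊥-elim (z≢y z≡y)
        ... | inj₂ (there z∈ys) = z∈ys
        b∈rs : b ∈ rs
        b∈rs = after-prefix (proj₂ E b) (unique-middle⇒∉prefix pre (proj₂ (proj₁ E′))) (λ b≡a → a≢b (sym b≡a))
        a∈rs′ : a ∈ rs′
        a∈rs′ = after-prefix (proj₂ E′ a) (unique-middle⇒∉prefix pre (proj₂ (proj₁ E))) a≢b
        same-tail : tail a ≡ tail b
        same-tail with walk-++⁻ pre (proj₁ (proj₁ E)) | walk-++⁻ pre (proj₁ (proj₁ E′))
        ... | _ , wp , cons ta≡ _ | _ , wp′ , cons tb≡ _ = trans ta≡ (trans (walk-end-unique wp wp′) (sym tb≡))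

  eulerianTrails-heapIso⇒≡ : ∀ {u es es′} → IsEulerianTrail D u es → IsEulerianTrail D u es′ →
                             HeapIso D (g D u es) (g D u es′) → es ≡ es′
  eulerianTrails-heapIso⇒≡ E E′ iso = common-prefix-extends E E′ iso [] _ _ refl refl

  -- Splicing cycles into a closed trail

  -- Splicing the cycle C, based at a vertex z of the closed walk
  -- before ++ after, into it at z; no arc of before leaves a vertex of C.
  record Insertion (u : Vertex) (ws : List Arc) : Set where
    field
      before after C : List Arc
      z              : Vertex
      split          : ws ≡ before ++ after
      before-walk    : Walk u before z
      C-walk         : Walk z C z
      C≢[]           : C ≢ []
      C-tails-unique : Unique (map tail C)
      before-avoids  : All (λ a → tail a ∉ vertSeq D z C) before

    inserted : Cyc D
    inserted = z , C

    result : List Arc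
    result = before ++ C ++ after

  -- δs₁ are the cycles of δs that close before the insertion point.
  record InsertedCycleSeq {u ws} (δs : List (Cyc D)) (I : Insertion u ws) : Set where
    constructor insertedCycleSeq
    open Insertion I
    field
      {δs₁ δs₂} : List (Cyc D)
      δs≡       : δs ≡ δs₁ ++ δs₂
      cycleSeq  : CycleSeq u result (δs₁ ++ inserted ∷ δs₂)
      apart     : All (λ δ → ¬ Concurrent D δ inserted) δs₁

  private
    -- the insertion point lies inside p ++ c: the inserted cycle closes first
    insert-first : ∀ {u p c r x ws βs} → FirstCycle u p c r x → CycleSeq u (p ++ r) βs →
                   (I : Insertion u ws) → ws ≡ p ++ c ++ r → ∀ ks → p ++ c ≡ Insertion.before I ++ ks →
                   CycleSeq u (Insertion.result I) (Insertion.inserted I ∷ (x , c) ∷ βs)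
    insert-first {u} {p} {c} {r} {ws = ws} fc seq I ws≡ ks pc≡ =
      peel (firstCycle before-walk C-walk after-walk C≢[] tails-unique)
           (subst (λ vs → CycleSeq u vs _) (trans (sym ws≡) split) (peel fc seq))
      where
        open Insertion I
        after-walk : Walk z after u
        after-walk = walk-drop-prefix before-walk
          (subst (λ vs → Walk u vs u) (trans (sym ws≡) split)
                 (walk-++⁺ (FirstCycle.prefix fc) (walk-++⁺ (FirstCycle.cycle fc) (FirstCycle.suffix fc))))
        before-tails-unique : Unique (map tail before)
        before-tails-unique = unique-++⁻ˡ (map tail before)
          (subst Unique (trans (cong (map tail) pc≡) (List.map-++ tail before ks)) (FirstCycle.tails-unique fc))
        tails-unique : Unique (map tail (before ++ C))
        tails-unique = subst Unique (sym (List.map-++ tail before C))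
          (unique-++⁺ before-tails-unique C-tails-unique disjoint)
          where
            disjoint : ∀ {v} → v ∈ map tail before → v ∈ map tail C → ⊥
            disjoint v∈ v∈C with ∈-map⁻ tail v∈
            ... | a , a∈ , refl = All.lookup before-avoids a∈ (tails⊆vertSeq C-walk v∈C)

    past-walk : ∀ {u p c r x ws} → FirstCycle u p c r x → (I : Insertion u ws) →
                ∀ ks → Insertion.before I ≡ (p ++ c) ++ ks → Walk x ks (Insertion.z I)
    past-walk {u} fc I ks before≡ = walk-drop-prefix (walk-++⁺ (FirstCycle.prefix fc) (FirstCycle.cycle fc))
                                      (subst (λ vs → Walk u vs (Insertion.z I)) before≡ (Insertion.before-walk I))

    -- the first cycle c closes before the insertion point: insert into p ++ r
    insertion-past : ∀ {u p c r x ws} → FirstCycle u p c r x → (I : Insertion u ws) →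
                     ∀ ks → Insertion.before I ≡ (p ++ c) ++ ks → r ≡ ks ++ Insertion.after I → Insertion u (p ++ r)
    insertion-past {u} {p} {c} fc I ks before≡ r≡ = record
      { before = p ++ ks ; after = after ; C = C ; z = z
      ; split = trans (cong (p ++_) r≡) (sym (List.++-assoc p ks after))
      ; before-walk = walk-++⁺ (FirstCycle.prefix fc) (past-walk fc I ks before≡)
      ; C-walk = C-walk ; C≢[] = C≢[] ; C-tails-unique = C-tails-unique
      ; before-avoids = All.++⁺ (All.++⁻ˡ p avoids) (All.++⁻ʳ c (All.++⁻ʳ p avoids))
      }
      where
        open Insertion I
        avoids : All (λ a → tail a ∉ vertSeq D z C) (p ++ c ++ ks)
        avoids = subst (All _) (trans before≡ (List.++-assoc p c ks)) before-avoids

    insert-into-empty : ∀ {u z before after C} → before ≡ [] → after ≡ [] → Walk u before z → Walk z C z →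
                        C ≢ [] → Unique (map tail C) → CycleSeq u (before ++ C ++ after) ((z , C) ∷ [])
    insert-into-empty refl refl nil wC C≢[] uniq = peel (firstCycle nil wC nil C≢[] uniq) []

  cycleSeq-insert : ∀ {u ws δs} → CycleSeq u ws δs → Walk u ws u → (I : Insertion u ws) → InsertedCycleSeq δs I
  cycleSeq-insert [] _ I =
    insertedCycleSeq {δs₁ = []} refl (insert-into-empty (List.++-conicalˡ before after (sym split))
                       (List.++-conicalʳ before after (sym split)) before-walk C-walk C≢[] C-tails-unique) []
    where open Insertion I
  cycleSeq-insert {u} (peel {p} {c} {r} {x} {βs} fc seq) w I
    with ++-≡-++⁻ (p ++ c) r (Insertion.before I) (Insertion.after I) (trans (List.++-assoc p c r) (Insertion.split I))
  ... | inj₂ (ks , pc≡ , _) = insertedCycleSeq {δs₁ = []} refl (insert-first fc seq I refl ks pc≡) []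
  ... | inj₁ (ks , before≡ , r≡)
    with cycleSeq-insert seq (FirstCycle.remainder fc) (insertion-past fc I ks before≡ r≡)
  ... | insertedCycleSeq {δs₁} {δs₂} refl seq′ apart = insertedCycleSeq {δs₁ = (x , c) ∷ δs₁} refl seq″ (c-apart ∷ apart)
    where
      open Insertion I
      open FirstCycle fc
      ks-walk = past-walk fc I ks before≡
      suffix′ : Walk x (ks ++ C ++ after) u
      suffix′ = walk-++⁺ ks-walk (walk-++⁺ C-walk (walk-drop-prefix ks-walk (subst (λ vs → Walk x vs u) r≡ suffix)))
      seq″ : CycleSeq u result ((x , c) ∷ δs₁ ++ inserted ∷ δs₂)
      seq″ = subst (λ vs → CycleSeq u vs ((x , c) ∷ δs₁ ++ inserted ∷ δs₂)) (sym result≡)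
               (peel (firstCycle prefix cycle suffix′ c≢[] tails-unique)
                     (subst (λ vs → CycleSeq u vs (δs₁ ++ inserted ∷ δs₂)) (List.++-assoc p ks (C ++ after)) seq′))
        where
          result≡ : result ≡ p ++ c ++ ks ++ C ++ after
          result≡ = trans (cong (_++ C ++ after) before≡)
                          (trans (List.++-assoc (p ++ c) ks (C ++ after)) (List.++-assoc p c (ks ++ C ++ after)))
      c-apart : ¬ Concurrent D (x , c) inserted
      c-apart (v , v∈c , v∈C) with ∈-map⁻ tail (closedWalk-vertSeq⊆tails cycle c≢[] v∈c)
      ... | a , a∈c , refl = All.lookup before-avoids (subst (a ∈_) (sym before≡) (∈-++⁺ˡ (∈-++⁺ʳ p a∈c))) v∈C

  -- The heap order of a labelled list, by recursion on the list: the head is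
  -- below j iff it meets some later piece below j.
  module LabelledReach {I : Set} (label : I → Cyc D) where

    Reach : (xs : List I) → Fin (length xs) → Fin (length xs) → Set
    Reach (x ∷ xs) fz     fz     = ⊤
    Reach (x ∷ xs) fz     (fs j) = ∃[ k ] (Concurrent D (label x) (label (lookup xs k)) × Reach xs k j)
    Reach (x ∷ xs) (fs i) fz     = ⊥
    Reach (x ∷ xs) (fs i) (fs j) = Reach xs i j

    reach-refl : ∀ xs i → Reach xs i i
    reach-refl (x ∷ xs) fz     = tt
    reach-refl (x ∷ xs) (fs i) = reach-refl xs i

    reach-trans : ∀ xs i j k → Reach xs i j → Reach xs j k → Reach xs i k
    reach-trans (x ∷ xs) fz     fz     k      _              r₂ = r₂
    reach-trans (x ∷ xs) fz     (fs j) (fs k) (m , cc , r₁)  r₂ = m , cc , reach-trans xs m j k r₁ r₂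
    reach-trans (x ∷ xs) (fs i) (fs j) (fs k) r₁             r₂ = reach-trans xs i j k r₁ r₂

    reach-step : ∀ xs i j → toℕ i < toℕ j → Concurrent D (label (lookup xs i)) (label (lookup xs j)) → Reach xs i j
    reach-step (x ∷ xs) fz     (fs j) _         cc = j , cc , reach-refl xs j
    reach-step (x ∷ xs) (fs i) (fs j) (s≤s i<j) cc = reach-step xs i j i<j cc

    reach? : (∀ x y → Dec (Concurrent D (label x) (label y))) → ∀ xs i j → Dec (Reach xs i j)
    reach? cc? (x ∷ xs) fz     fz     = yes tt
    reach? cc? (x ∷ xs) fz     (fs j) = Fin.any? (λ k → cc? x (lookup xs k) ×-dec reach? cc? xs k j)
    reach? cc? (x ∷ xs) (fs i) fz     = no (λ ())
    reach? cc? (x ∷ xs) (fs i) (fs j) = reach? cc? xs i j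

  open LabelledReach (λ β → β)

  private
    heapOrder-∷⁻ : ∀ β βs i j → HeapOrder (β ∷ βs) (fs i) j → ∃[ j′ ] (j ≡ fs j′ × HeapOrder βs i j′)
    heapOrder-∷⁻ β βs i _ ε = i , refl , ε
    heapOrder-∷⁻ β βs i j (_◅_ {j = fz}   (() , _) _)
    heapOrder-∷⁻ β βs i j (_◅_ {j = fs k} (i<k , cc) sts) with heapOrder-∷⁻ β βs k j sts
    ... | j′ , refl , sts′ = j′ , refl , ((ℕ.≤-pred i<k , cc) ◅ sts′)

  heapOrder⇒reach : ∀ βs i j → HeapOrder βs i j → Reach βs i j
  heapOrder⇒reach (β ∷ βs) fz     _ ε = tt
  heapOrder⇒reach (β ∷ βs) fz     j (_◅_ {j = fz}   (() , _) _)
  heapOrder⇒reach (β ∷ βs) fz     j (_◅_ {j = fs k} (_ , cc) sts) with heapOrder-∷⁻ β βs k j sts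
  ... | j′ , refl , sts′ = k , cc , heapOrder⇒reach βs k j′ sts′
  heapOrder⇒reach (β ∷ βs) (fs i) j sts with heapOrder-∷⁻ β βs i j sts
  ... | j′ , refl , sts′ = heapOrder⇒reach βs i j′ sts′

  reach⇒heapOrder : ∀ βs i j → Reach βs i j → HeapOrder βs i j
  reach⇒heapOrder (β ∷ βs) fz     fz     _            = ε
  reach⇒heapOrder (β ∷ βs) fz     (fs j) (k , cc , r) = (s≤s z≤n , cc) ◅ heapOrder-∷ β βs (reach⇒heapOrder βs k j r)
  reach⇒heapOrder (β ∷ βs) (fs i) (fs j) r            = heapOrder-∷ β βs (reach⇒heapOrder βs i j r)

  record ListHeapIso (xs ys : List (Cyc D)) : Set where
    field
      to      : Fin (length xs) → Fin (length ys)
      from    : Fin (length ys) → Fin (length xs)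
      to-from : ∀ j → to (from j) ≡ j
      from-to : ∀ i → from (to i) ≡ i
      reach⁺  : ∀ i j → Reach xs i j → Reach ys (to i) (to j)
      reach⁻  : ∀ i j → Reach ys (to i) (to j) → Reach xs i j
      label   : ∀ i → lookup ys (to i) ≡ lookup xs i

  listHeapIso-refl : ∀ xs → ListHeapIso xs xs
  listHeapIso-refl xs = record
    { to = λ i → i ; from = λ i → i ; to-from = λ _ → refl ; from-to = λ _ → refl
    ; reach⁺ = λ _ _ r → r ; reach⁻ = λ _ _ r → r ; label = λ _ → refl }

  listHeapIso-trans : ∀ {xs ys zs} → ListHeapIso xs ys → ListHeapIso ys zs → ListHeapIso xs zs
  listHeapIso-trans A B = record
    { to      = λ i → B.to (A.to i)
    ; from    = λ k → A.from (B.from k)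
    ; to-from = λ k → trans (cong B.to (A.to-from (B.from k))) (B.to-from k)
    ; from-to = λ i → trans (cong A.from (B.from-to (A.to i))) (A.from-to i)
    ; reach⁺  = λ i j r → B.reach⁺ (A.to i) (A.to j) (A.reach⁺ i j r)
    ; reach⁻  = λ i j r → A.reach⁻ i j (B.reach⁻ (A.to i) (A.to j) r)
    ; label   = λ i → trans (B.label (A.to i)) (A.label i)
    }
    where module A = ListHeapIso A
          module B = ListHeapIso B

  listHeapIso-∷ : ∀ β {xs ys} → ListHeapIso xs ys → ListHeapIso (β ∷ xs) (β ∷ ys)
  listHeapIso-∷ β {xs} {ys} A = record
    { to = to ; from = from ; to-from = to-from ; from-to = from-to ; reach⁺ = reach⁺ ; reach⁻ = reach⁻ ; label = label }
    where
      module A = ListHeapIso A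
      to : Fin (suc (length xs)) → Fin (suc (length ys))
      to fz     = fz
      to (fs i) = fs (A.to i)
      from : Fin (suc (length ys)) → Fin (suc (length xs))
      from fz     = fz
      from (fs j) = fs (A.from j)
      to-from : ∀ j → to (from j) ≡ j
      to-from fz     = refl
      to-from (fs j) = cong fs (A.to-from j)
      from-to : ∀ i → from (to i) ≡ i
      from-to fz     = refl
      from-to (fs i) = cong fs (A.from-to i)
      reach⁺ : ∀ i j → Reach (β ∷ xs) i j → Reach (β ∷ ys) (to i) (to j)
      reach⁺ fz     fz     _            = tt
      reach⁺ fz     (fs j) (k , cc , r) = A.to k , subst (Concurrent D β) (sym (A.label k)) cc , A.reach⁺ k j r
      reach⁺ (fs i) (fs j) r            = A.reach⁺ i j r
      reach⁻ : ∀ i j → Reach (β ∷ ys) (to i) (to j) → Reach (β ∷ xs) i j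
      reach⁻ fz     fz     _            = tt
      reach⁻ fz     (fs j) (k , cc , r) =
        A.from k , subst (Concurrent D β) (trans (cong (lookup ys) (sym (A.to-from k))) (A.label (A.from k))) cc ,
        A.reach⁻ (A.from k) j (subst (λ k′ → Reach ys k′ (A.to j)) (sym (A.to-from k)) r)
      reach⁻ (fs i) (fs j) r            = A.reach⁻ i j r
      label : ∀ i → lookup (β ∷ ys) (to i) ≡ lookup (β ∷ xs) i
      label fz     = refl
      label (fs i) = A.label i

  private
    swap₀₁ : ∀ {n} → Fin (suc (suc n)) → Fin (suc (suc n))
    swap₀₁ fz           = fs fz
    swap₀₁ (fs fz)      = fz
    swap₀₁ (fs (fs i))  = fs (fs i)

    swap₀₁-involutive : ∀ {n} (i : Fin (suc (suc n))) → swap₀₁ (swap₀₁ i) ≡ i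
    swap₀₁-involutive fz          = refl
    swap₀₁-involutive (fs fz)     = refl
    swap₀₁-involutive (fs (fs i)) = refl

    swap-reach : ∀ β γ xs → ¬ Concurrent D β γ → ∀ i j → Reach (β ∷ γ ∷ xs) i j → Reach (γ ∷ β ∷ xs) (swap₀₁ i) (swap₀₁ j)
    swap-reach β γ xs apart fz          fz          _                 = tt
    swap-reach β γ xs apart fz          (fs fz)     (fz , cc , _)     = ⊥-elim (apart cc)
    swap-reach β γ xs apart fz          (fs (fs j)) (fz , cc , _)     = ⊥-elim (apart cc)
    swap-reach β γ xs apart fz          (fs (fs j)) (fs k , cc , r)   = k , cc , r
    swap-reach β γ xs apart (fs fz)     (fs fz)     _                 = tt
    swap-reach β γ xs apart (fs fz)     (fs (fs j)) (k , cc , r)      = fs k , cc , r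
    swap-reach β γ xs apart (fs (fs i)) (fs (fs j)) r                 = r

  listHeapIso-swap : ∀ β γ xs → ¬ Concurrent D β γ → ListHeapIso (β ∷ γ ∷ xs) (γ ∷ β ∷ xs)
  listHeapIso-swap β γ xs apart = record
    { to = swap₀₁ ; from = swap₀₁ ; to-from = swap₀₁-involutive ; from-to = swap₀₁-involutive
    ; reach⁺ = swap-reach β γ xs apart
    ; reach⁻ = λ i j r → subst₂ (Reach (β ∷ γ ∷ xs)) (swap₀₁-involutive i) (swap₀₁-involutive j)
                           (swap-reach γ β xs (apart ∘ concurrent-sym) (swap₀₁ i) (swap₀₁ j) r)
    ; label  = label }
    where
      label : ∀ i → lookup (γ ∷ β ∷ xs) (swap₀₁ i) ≡ lookup (β ∷ γ ∷ xs) i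
      label fz          = refl
      label (fs fz)     = refl
      label (fs (fs i)) = refl

  listHeapIso-move : ∀ β δs₁ δs₂ → All (λ δ → ¬ Concurrent D δ β) δs₁ → ListHeapIso (δs₁ ++ β ∷ δs₂) (β ∷ δs₁ ++ δs₂)
  listHeapIso-move β []        δs₂ _ = listHeapIso-refl _
  listHeapIso-move β (δ ∷ δs₁) δs₂ (apart ∷ apart′) =
    listHeapIso-trans (listHeapIso-∷ δ (listHeapIso-move β δs₁ δs₂ apart′)) (listHeapIso-swap δ β (δs₁ ++ δs₂) apart)

  record FirstVisit (v : Vertex) (ws : List Arc) (VB : List Vertex) : Set where
    constructor firstVisit
    field
      {before after} : List Arc
      {z}            : Vertex
      split          : ws ≡ before ++ after
      before-walk    : Walk v before z
      z∈             : z ∈ VB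
      before-avoids  : All (λ a → tail a ∉ VB) before

  walk-first-visit : ∀ {v w} ws (VB : List Vertex) → Walk v ws w → ∀ {t} → t ∈ VB → t ∈ vertSeq D v ws → FirstVisit v ws VB
  walk-first-visit {v} ws VB w t∈VB t∈ws with v ∈? VB
  ... | yes v∈VB = firstVisit refl nil v∈VB []
  walk-first-visit []       VB nil        t∈VB (here refl) | no v∉VB = ⊥-elim (v∉VB t∈VB)
  walk-first-visit (a ∷ ws) VB (cons e w) t∈VB (here refl) | no v∉VB = ⊥-elim (v∉VB t∈VB)
  walk-first-visit (a ∷ ws) VB (cons e w) t∈VB (there t∈) | no v∉VB with walk-first-visit ws VB w t∈VB t∈
  ... | firstVisit split w₁ z∈VB avoids =
        firstVisit (cong (a ∷_) split) (cons e w₁) z∈VB ((λ m → v∉VB (subst (_∈ VB) e m)) ∷ avoids)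

  -- the cycle (y , c₁ ++ c₂) rotated to start at z, the tail of the first arc of c₂
  record Rotation (y : Vertex) (c : List Arc) (z : Vertex) : Set where
    field
      c₁ c₂        : List Arc
      split        : c ≡ c₁ ++ c₂
      c₂≢[]        : c₂ ≢ []
      walk         : Walk z (c₂ ++ c₁) z
      tails-unique : Unique (map tail (c₂ ++ c₁))
      vertices⁻    : ∀ {v} → v ∈ vertSeq D z (c₂ ++ c₁) → v ∈ vertSeq D y c
      vertices⁺    : ∀ {v} → v ∈ vertSeq D y c → v ∈ vertSeq D z (c₂ ++ c₁)

    rotated : List Arc
    rotated = c₂ ++ c₁

    rotated≢[] : rotated ≢ []
    rotated≢[] eq = c₂≢[] (List.++-conicalˡ c₂ c₁ eq)

    rotated↭ : rotated ↭ c
    rotated↭ = subst (rotated ↭_) (sym split) (Perm.++-comm c₂ c₁)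

  rotate : ∀ {y c z} → IsCycle D (y , c) → z ∈ vertSeq D y c → Rotation y c z
  rotate {y} {c} ((wc , _) , c≢[] , heads-unique) z∈ with ∈-map⁻ tail (closedWalk-vertSeq⊆tails wc c≢[] z∈)
  ... | a , a∈ , refl with ∈-∃++ a∈
  ... | c₁ , c₂′ , refl with walk-++⁻ c₁ wc
  ... | _ , w₁ , cons refl w₂ = record
    { c₁ = c₁ ; c₂ = a ∷ c₂′ ; split = refl ; c₂≢[] = λ () ; walk = wR ; tails-unique = tails-unique
    ; vertices⁻ = λ v∈ → tails⊆vertSeq wc (tails-swap (a ∷ c₂′) c₁ (closedWalk-vertSeq⊆tails wR (λ ()) v∈))
    ; vertices⁺ = λ v∈ → tails⊆vertSeq wR (tails-swap c₁ (a ∷ c₂′) (closedWalk-vertSeq⊆tails wc c≢[] v∈))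
    }
    where
      wR : Walk (tail a) ((a ∷ c₂′) ++ c₁) (tail a)
      wR = walk-++⁺ (cons refl w₂) w₁
      tails-swap : ∀ xs ys {v} → v ∈ map tail (xs ++ ys) → v ∈ map tail (ys ++ xs)
      tails-swap xs ys = Perm.∈-resp-↭ (Perm.map⁺ tail (Perm.++-comm xs ys))
      tails-unique : Unique (map tail ((a ∷ c₂′) ++ c₁))
      tails-unique = unique-resp-↭ (Perm.map⁺ tail (Perm.++-comm c₁ (a ∷ c₂′)))
                       (unique-resp-↭ (closedWalk-heads↭tails wc) heads-unique)

  private
    -- the splice point is never the end of the trail, so the last arc stays last
    first-visit-not-at-end : ∀ {u ws₁ ws₂ z} {VB : List Vertex} → ws₁ ++ ws₂ ≢ [] → Walk u (ws₁ ++ ws₂) u →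
                             Walk u ws₁ z → z ∈ VB → All (λ a → tail a ∉ VB) ws₁ → ws₂ ≢ []
    first-visit-not-at-end {ws₁ = []}     ws≢[] _ _ _ _ refl = ws≢[] refl
    first-visit-not-at-end {u} {ws₁ = a ∷ ws₁} {VB = VB} _ w (cons e w₁) z∈VB (a-avoids ∷ _) refl =
      a-avoids (subst (_∈ VB) (trans (walk-end-unique (cons e w₁) w′) (sym e)) z∈VB)
      where w′ = subst (λ vs → Walk u vs u) (List.++-identityʳ (a ∷ ws₁)) w

    insert-keeps-last : ∀ (ws₁ ws₂ C ys : List Arc) a → ws₁ ++ ws₂ ≡ ys ∷ʳ a → ws₂ ≢ [] →
                        ∃[ ys′ ] ws₁ ++ C ++ ws₂ ≡ ys′ ∷ʳ a
    insert-keeps-last ws₁ ws₂ C ys a eq ws₂≢[] with initLast ws₂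
    ... | []        = ⊥-elim (ws₂≢[] refl)
    ... | ws₂′ ∷ʳ′ b with List.∷ʳ-injective (ws₁ ++ ws₂′) ys (trans (List.++-assoc ws₁ ws₂′ [ b ]) eq)
    ... | _ , refl = ws₁ ++ C ++ ws₂′ , trans (cong (ws₁ ++_) (sym (List.++-assoc C ws₂′ [ b ])))
                                              (sym (List.++-assoc ws₁ (C ++ ws₂′) [ b ]))

    vertSeq-insert⁺ˡ : ∀ {u z v} ws₁ C ws₂ → Walk u ws₁ z → v ∈ vertSeq D u (ws₁ ++ ws₂) → v ∈ vertSeq D u (ws₁ ++ C ++ ws₂)
    vertSeq-insert⁺ˡ {u} {z} {v} ws₁ C ws₂ w m rewrite walk-vertSeq-++ ws₂ w | walk-vertSeq-++ (C ++ ws₂) w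
      with ∈-++⁻ (map tail ws₁) m
    ... | inj₁ m₁         = ∈-++⁺ˡ m₁
    ... | inj₂ (here e)   = ∈-++⁺ʳ (map tail ws₁) (here e)
    ... | inj₂ (there m₂) =
      ∈-++⁺ʳ (map tail ws₁) (there (subst (v ∈_) (sym (List.map-++ head C ws₂)) (∈-++⁺ʳ (map head C) m₂)))

    vertSeq-insert⁺ʳ : ∀ {u z v} ws₁ C ws₂ → Walk u ws₁ z → v ∈ vertSeq D z C → v ∈ vertSeq D u (ws₁ ++ C ++ ws₂)
    vertSeq-insert⁺ʳ {u} {z} {v} ws₁ C ws₂ w m rewrite walk-vertSeq-++ (C ++ ws₂) w with m
    ... | here e    = ∈-++⁺ʳ (map tail ws₁) (here e)
    ... | there m₂  = ∈-++⁺ʳ (map tail ws₁) (there (subst (v ∈_) (sym (List.map-++ head C ws₂)) (∈-++⁺ˡ m₂)))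

  module Splicing {I : Set} (label : I → Cyc D) where
    module L = LabelledReach label

    Rotated : Cyc D → I → Set
    Rotated γ x = CycEq D γ (label x)
                × (∀ {v} → v ∈ cycVerts D γ → v ∈ cycVerts D (label x))
                × (∀ {v} → v ∈ cycVerts D (label x) → v ∈ cycVerts D γ)

    arcsOfI : List I → List Arc
    arcsOfI xs = arcsOf (map label xs)

    ∈-arcsOfI⁺ : ∀ {x a} xs → x ∈ xs → a ∈ cycArcs D (label x) → a ∈ arcsOfI xs
    ∈-arcsOfI⁺ (y ∷ xs) (here refl) a∈ = ∈-++⁺ˡ a∈
    ∈-arcsOfI⁺ (y ∷ xs) (there x∈)  a∈ = ∈-++⁺ʳ (cycArcs D (label y)) (∈-arcsOfI⁺ xs x∈ a∈)

    ∈-arcsOfI⁻ : ∀ {a} xs → a ∈ arcsOfI xs → ∃[ x ] (x ∈ xs × a ∈ cycArcs D (label x))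
    ∈-arcsOfI⁻ (y ∷ xs) a∈ with ∈-++⁻ (cycArcs D (label y)) a∈
    ... | inj₁ a∈y  = y , here refl , a∈y
    ... | inj₂ a∈xs with ∈-arcsOfI⁻ xs a∈xs
    ... | x , x∈ , a∈x = x , there x∈ , a∈x

    unique-arcsOfI : ∀ xs → Unique xs → All (λ x → IsCycle D (label x)) xs →
                     (∀ {a} x y → a ∈ cycArcs D (label x) → a ∈ cycArcs D (label y) → x ≡ y) → Unique (arcsOfI xs)
    unique-arcsOfI []       _          _                   _        = []
    unique-arcsOfI (x ∷ xs) (x∉ ∷ uxs) (x-cycle ∷ cycles) disjoint =
      unique-++⁺ (proj₂ (proj₁ x-cycle)) (unique-arcsOfI xs uxs cycles disjoint)
        (λ a∈x a∈xs → let (y , y∈ , a∈y) = ∈-arcsOfI⁻ xs a∈xs in All.lookup x∉ y∈ (disjoint x y a∈x a∈y))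

    -- A closed trail at u ending with e, built from the pieces xs: its cycle
    -- sequence is isomorphic, as a heap, to rotations of the labels of xs.
    record SplicedTrail (u : Vertex) (e : Arc) (xs : List I) : Set where
      field
        ws       : List Arc
        walk     : Walk u ws u
        arcs↭    : ws ↭ arcsOfI xs
        ends-e   : ∃[ ys ] ws ≡ ys ∷ʳ e
        δs γs    : List (Cyc D)
        cycleSeq : CycleSeq u ws δs
        iso      : ListHeapIso δs γs
        rotated  : Pointwise Rotated γs xs
        vertices : ∀ {x v} → x ∈ xs → v ∈ cycVerts D (label x) → v ∈ vertSeq D u ws

    -- Splice the cycle x into the trail at the first vertex it shares with
    -- it; x then closes first, after pieces it does not meet.
    splice : ∀ {u e xs} x → IsCycle D (label x) → (∃[ y ] (y ∈ xs × Concurrent D (label x) (label y))) →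
             SplicedTrail u e xs → SplicedTrail u e (x ∷ xs)
    splice {u} {e} {xs} x x-cycle (y , y∈ , v , v∈x , v∈y) T = record
      { ws       = before ++ C ++ after
      ; walk     = walk-++⁺ before-walk (walk-++⁺ R.walk after-walk)
      ; arcs↭    = ↭-trans (Perm.shifts before C)
                           (Perm.++⁺ R.rotated↭ (subst (_↭ arcsOfI xs) split T.arcs↭))
      ; ends-e   = insert-keeps-last before after C (proj₁ T.ends-e) e (trans (sym split) (proj₂ T.ends-e))
                     (first-visit-not-at-end (λ eq → ∷ʳ≢[] (proj₁ T.ends-e) (trans (sym (proj₂ T.ends-e)) (trans split eq)))
                                             walk′ before-walk z∈ before-avoids)
      ; δs       = δs₁ ++ (z , C) ∷ δs₂
      ; γs       = (z , C) ∷ T.γs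
      ; cycleSeq = cycleSeq
      ; iso      = listHeapIso-trans (listHeapIso-move (z , C) δs₁ δs₂ apart)
                                     (listHeapIso-∷ (z , C) (subst (λ δs → ListHeapIso δs T.γs) δs≡ T.iso))
      ; rotated  = ((R.c₂ , R.c₁ , refl , R.split) , R.vertices⁻ , R.vertices⁺) ∷ T.rotated
      ; vertices = vertices
      }
      where
        module T = SplicedTrail T
        VB = cycVerts D (label x)
        open FirstVisit (walk-first-visit T.ws VB T.walk v∈x (T.vertices y∈ v∈y))
        R = rotate x-cycle z∈
        module R = Rotation R
        C = R.rotated
        walk′ : Walk u (before ++ after) u
        walk′ = subst (λ vs → Walk u vs u) split T.walk
        after-walk : Walk z after u
        after-walk = walk-drop-prefix before-walk walk′
        insertion : Insertion u T.ws
        insertion = record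
          { before = before ; after = after ; C = C ; z = z ; split = split ; before-walk = before-walk
          ; C-walk = R.walk ; C≢[] = R.rotated≢[] ; C-tails-unique = R.tails-unique
          ; before-avoids = All.map (λ a-avoids m → a-avoids (R.vertices⁻ m)) before-avoids }
        open InsertedCycleSeq (cycleSeq-insert T.cycleSeq T.walk insertion)
        vertices : ∀ {x′ v} → x′ ∈ x ∷ xs → v ∈ cycVerts D (label x′) → v ∈ vertSeq D u (before ++ C ++ after)
        vertices (here refl) m = vertSeq-insert⁺ʳ before C after before-walk (R.vertices⁺ m)
        vertices (there x′∈) m = vertSeq-insert⁺ˡ before C after before-walk
                                   (subst (λ vs → _ ∈ vertSeq D u vs) split (T.vertices x′∈ m))

    MeetsLater : List I → List I → Set
    MeetsLater []       ys = ⊤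
    MeetsLater (x ∷ xs) ys = (∃[ y ] (y ∈ xs ++ ys × Concurrent D (label x) (label y))) × MeetsLater xs ys

    splice-all : ∀ {u e ys} xs → All (λ x → IsCycle D (label x)) xs → MeetsLater xs ys →
                 SplicedTrail u e ys → SplicedTrail u e (xs ++ ys)
    splice-all []       []                _                 T = T
    splice-all (x ∷ xs) (x-cycle ∷ cycles) (meets , later) T = splice x x-cycle meets (splice-all xs cycles later T)

    singleTrail : ∀ {x z} → IsCycle D (label x) → z ∈ cycVerts D (label x) → ∃[ e ] SplicedTrail z e [ x ]
    singleTrail {x} {z} x-cycle z∈ = proj₁ (proj₂ last) , record
      { ws       = rotated
      ; walk     = walk
      ; arcs↭    = ↭-trans rotated↭ (↭-sym (Perm.++-identityʳ _))
      ; ends-e   = proj₁ last , proj₂ (proj₂ last)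
      ; δs       = (z , rotated) ∷ []
      ; γs       = (z , rotated) ∷ []
      ; cycleSeq = subst (λ vs → CycleSeq z vs ((z , rotated) ∷ [])) (List.++-identityʳ rotated)
                         (peel (firstCycle nil walk nil rotated≢[] tails-unique) [])
      ; iso      = listHeapIso-refl _
      ; rotated  = ((c₂ , c₁ , refl , split) , vertices⁻ , vertices⁺) ∷ []
      ; vertices = λ { (here refl) → vertices⁺ }
      }
      where
        open Rotation (rotate x-cycle z∈)
        last = ≢[]⇒∷ʳ rotated rotated≢[]

    singleTrail-ending : ∀ {x e} → IsCycle D (label x) → e ∈ cycArcs D (label x) → SplicedTrail (head e) e [ x ]
    singleTrail-ending {x} {e} x-cycle e∈ with singleTrail x-cycle (there (∈-map⁺ head e∈))
    ... | e′ , T = subst (λ a → SplicedTrail (head e) a [ x ]) e′≡e T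
      where
        module T = SplicedTrail T
        e′∈ : e′ ∈ cycArcs D (label x)
        e′∈ = Perm.∈-resp-↭ (↭-trans T.arcs↭ (Perm.++-identityʳ _))
                (subst (e′ ∈_) (sym (proj₂ T.ends-e)) (∈-++⁺ʳ (proj₁ T.ends-e) (here refl)))
        e′≡e : e′ ≡ e
        e′≡e = unique-map⇒injective head (proj₂ (proj₂ x-cycle)) e′∈ e∈
                 (walk-last-head (proj₁ T.ends-e) (subst (λ vs → Walk (head e) vs (head e)) (proj₂ T.ends-e) T.walk))

    rotated-concurrent⁺ : ∀ {γ x γ′ x′} → Rotated γ x → Rotated γ′ x′ → Concurrent D γ γ′ → Concurrent D (label x) (label x′)
    rotated-concurrent⁺ (_ , r , _) (_ , r′ , _) (v , m , m′) = v , r m , r′ m′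

    rotated-concurrent⁻ : ∀ {γ x γ′ x′} → Rotated γ x → Rotated γ′ x′ → Concurrent D (label x) (label x′) → Concurrent D γ γ′
    rotated-concurrent⁻ (_ , _ , r) (_ , _ , r′) (v , m , m′) = v , r m , r′ m′

    index⁺ : ∀ {γs xs} → Pointwise Rotated γs xs → Fin (length γs) → Fin (length xs)
    index⁺ (_ ∷ _)   fz     = fz
    index⁺ (_ ∷ rot) (fs i) = fs (index⁺ rot i)

    index⁻ : ∀ {γs xs} → Pointwise Rotated γs xs → Fin (length xs) → Fin (length γs)
    index⁻ (_ ∷ _)   fz     = fz
    index⁻ (_ ∷ rot) (fs i) = fs (index⁻ rot i)

    index⁺∘index⁻ : ∀ {γs xs} (rot : Pointwise Rotated γs xs) j → index⁺ rot (index⁻ rot j) ≡ j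
    index⁺∘index⁻ (_ ∷ _)   fz     = refl
    index⁺∘index⁻ (_ ∷ rot) (fs j) = cong fs (index⁺∘index⁻ rot j)

    index⁻∘index⁺ : ∀ {γs xs} (rot : Pointwise Rotated γs xs) i → index⁻ rot (index⁺ rot i) ≡ i
    index⁻∘index⁺ (_ ∷ _)   fz     = refl
    index⁻∘index⁺ (_ ∷ rot) (fs i) = cong fs (index⁻∘index⁺ rot i)

    rotated-lookup : ∀ {γs xs} (rot : Pointwise Rotated γs xs) i → Rotated (lookup γs i) (lookup xs (index⁺ rot i))
    rotated-lookup (r ∷ _)   fz     = r
    rotated-lookup (_ ∷ rot) (fs i) = rotated-lookup rot i

    rotated-reach⁺ : ∀ {γs xs} (rot : Pointwise Rotated γs xs) i j → Reach γs i j → L.Reach xs (index⁺ rot i) (index⁺ rot j)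
    rotated-reach⁺ (r ∷ rot) fz     fz     _            = tt
    rotated-reach⁺ (r ∷ rot) fz     (fs j) (k , cc , t) =
      index⁺ rot k , rotated-concurrent⁺ r (rotated-lookup rot k) cc , rotated-reach⁺ rot k j t
    rotated-reach⁺ (r ∷ rot) (fs i) (fs j) t            = rotated-reach⁺ rot i j t

    rotated-reach⁻ : ∀ {γs xs} (rot : Pointwise Rotated γs xs) i j → L.Reach xs (index⁺ rot i) (index⁺ rot j) → Reach γs i j
    rotated-reach⁻ (r ∷ rot) fz     fz     _            = tt
    rotated-reach⁻ {xs = x ∷ xs} (r ∷ rot) fz (fs j) (k , cc , t) =
      index⁻ rot k ,
      rotated-concurrent⁻ r (rotated-lookup rot (index⁻ rot k))
        (subst (λ k′ → Concurrent D (label x) (label (lookup xs k′))) (sym (index⁺∘index⁻ rot k)) cc) ,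
      rotated-reach⁻ rot (index⁻ rot k) j (subst (λ k′ → L.Reach xs k′ (index⁺ rot j)) (sym (index⁺∘index⁻ rot k)) t)
    rotated-reach⁻ (r ∷ rot) (fs i) (fs j) t            = rotated-reach⁻ rot i j t

  -- Linear extensions of a decomposition pyramid

  -- The heap order is an arbitrary relation, so it is only decidable under a
  -- double negation; every goal it is used for below is decidable, hence stable.
  module Linearisation (H : Heap D) (isHeap : IsHeap D H) (top : Fin (Heap.size H)) (topMax : IsMaxPiece D H top) where
    open Heap H renaming (size to n; _≤ₕ_ to _≼_; label to piece)
    module ≤ = IsHeap isHeap

    _⊑_ : Fin n → Fin n → Set
    x ⊑ y = Concurrent D (piece x) (piece y) × x ≼ y

    _⊑?_ : ∀ x y → Dec (x ⊑ y)
    x ⊑? y with concurrent? (piece x) (piece y)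
    ... | no ¬cc = no (¬cc ∘ proj₁)
    ... | yes cc with ≤.concComp x y cc
    ...   | inj₁ x≼y = yes (cc , x≼y)
    ...   | inj₂ y≼x with x ≟ y
    ...     | yes refl = yes (cc , ≤.refl′ x)
    ...     | no x≢y   = no (λ (_ , x≼y) → x≢y (≤.antisym x y x≼y y≼x))

    DecidableOrder : Set
    DecidableOrder = ∀ x y → Dec (x ≼ y)

    ¬¬-decidableOrder : ¬ ¬ DecidableOrder
    ¬¬-decidableOrder = ¬¬-Π-Fin n (λ x → ¬¬-Π-Fin n (λ y → ¬¬-excluded-middle))

    Minimal : List (Fin n) → Fin n → Set
    Minimal S m = All (λ y → y ⊑ m → y ≡ m) S

    private
      minimal-exists-classically : DecidableOrder → ∀ s S → Any (Minimal (s ∷ S)) (s ∷ S)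
      minimal-exists-classically _≼?_ s S =
        Any.map (λ m≡ → subst (Minimal (s ∷ S)) m≡ minimal)
                (argmin-all below {P = _∈ s ∷ S} (here refl) (All.tabulate (λ y∈ → y∈)))
        where
          below : Fin n → ℕ
          below x = count (_≼ x) (_≼? x)
          m = argmin below s (s ∷ S)
          minimal : Minimal (s ∷ S) m
          minimal = All.tabulate λ {y} y∈ (_ , y≼m) → decidable-stable (y ≟ m) λ y≢m →
            ℕ.<⇒≱ (count-mono-< (_≼ y) (_≼ m) (_≼? y) (_≼? m) (λ z z≼y → ≤.trans′ z y m z≼y y≼m) m (≤.refl′ m)
                                (λ m≼y → y≢m (≤.antisym y m y≼m m≼y)))
                  (All.lookup (f[argmin]≤f[xs] {f = below} s (s ∷ S)) y∈)

    -- opaque: unfolding this classical construction during type checking is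
    -- prohibitively expensive
    opaque
      minimal-exists : ∀ s S → ∃[ m ] (m ∈ s ∷ S × Minimal (s ∷ S) m)
      minimal-exists s S = find (decidable-stable (Any.any? minimal? (s ∷ S))
                                  (λ ¬min → ¬¬-decidableOrder (λ _≼?_ → ¬min (minimal-exists-classically _≼?_ s S))))
        where
          minimal? : ∀ m → Dec (Minimal (s ∷ S) m)
          minimal? m = All.all? (λ y → (y ⊑? m) →-dec (y ≟ m)) (s ∷ S)

    record Listing (S : List (Fin n)) : Set where
      field
        list       : List (Fin n)
        ⊆S         : ∀ {x} → x ∈ list → x ∈ S
        ⊇S         : ∀ {x} → x ∈ S → x ∈ list
        unique     : Unique list
        respects-⊑ : ∀ {x y} → x ⊑ y → x ≢ y → x ∈ list → y ∈ list → Precedes x y list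

    listing : ∀ k S → length S ≤ k → Unique S → Listing S
    listing k       []      _  _ = record { list = [] ; ⊆S = λ () ; ⊇S = λ () ; unique = [] ; respects-⊑ = λ _ _ () }
    listing zero    (s ∷ S) () _
    listing (suc k) (s ∷ S) S≤ uS with minimal-exists s S
    ... | m , m∈ , minimal with ∈-∃++ m∈
    ... | S₁ , S₂ , S≡ = record
      { list = m ∷ Rest.list ; ⊆S = ⊆S ; ⊇S = ⊇S
      ; unique = unique-∷⁺ (m∉rest ∘ Rest.⊆S) Rest.unique ; respects-⊑ = respects }
      where
        rest↭ : s ∷ S ↭ m ∷ S₁ ++ S₂
        rest↭ = subst (_↭ m ∷ S₁ ++ S₂) (sym S≡) (Perm.shift m S₁ S₂)
        u-m∷rest : Unique (m ∷ S₁ ++ S₂)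
        u-m∷rest = unique-resp-↭ rest↭ uS
        m∉rest : m ∉ S₁ ++ S₂
        m∉rest = Unique.Unique[x∷xs]⇒x∉xs u-m∷rest
        rest≤ : length (S₁ ++ S₂) ≤ k
        rest≤ = ℕ.≤-pred (subst (_≤ suc k) (Perm.↭-length rest↭) S≤)
        module Rest = Listing (listing k (S₁ ++ S₂) rest≤ (unique-++⁻ʳ [ m ] u-m∷rest))
        ⊆S : ∀ {x} → x ∈ m ∷ Rest.list → x ∈ s ∷ S
        ⊆S (here refl) = m∈
        ⊆S (there x∈)  = Perm.∈-resp-↭ (↭-sym rest↭) (there (Rest.⊆S x∈))
        ⊇S : ∀ {x} → x ∈ s ∷ S → x ∈ m ∷ Rest.list
        ⊇S x∈ with Perm.∈-resp-↭ rest↭ x∈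
        ... | here x≡m = here x≡m
        ... | there x∈rest = there (Rest.⊇S x∈rest)
        respects : ∀ {x y} → x ⊑ y → x ≢ y → x ∈ m ∷ Rest.list → y ∈ m ∷ Rest.list → Precedes x y (m ∷ Rest.list)
        respects x⊑y x≢y x∈        (here refl) = ⊥-elim (x≢y (All.lookup minimal (⊆S x∈) x⊑y))
        respects x⊑y x≢y (here refl) (there y∈) = [] , Rest.list , refl , y∈
        respects x⊑y x≢y (there x∈)  (there y∈) with Rest.respects-⊑ x⊑y x≢y x∈ y∈
        ... | ys , zs , eq , y∈zs = m ∷ ys , zs , cong (m ∷_) eq , y∈zs

    private
      ≢top? : ∀ x → Dec (x ≢ top)
      ≢top? x = ¬? (x ≟ top)

    others : List (Fin n)
    others = filter ≢top? (allFin n)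

    top∉others : top ∉ others
    top∉others top∈ = proj₂ (∈-filter⁻ ≢top? {xs = allFin n} top∈) refl

    module Others = Listing (listing (length others) others ℕ.≤-refl (Unique.filter⁺ _ (Unique.allFin⁺ n)))

    order : List (Fin n)
    order = Others.list ∷ʳ top

    unique-order : Unique order
    unique-order = unique-++⁺ Others.unique ([] ∷ []) λ { x∈ (here refl) → top∉others (Others.⊆S x∈) }

    ∈-order : ∀ x → x ∈ order
    ∈-order x with x ≟ top
    ... | yes refl = ∈-++⁺ʳ Others.list (here refl)
    ... | no x≢top = ∈-++⁺ˡ (Others.⊇S (∈-filter⁺ ≢top? (∈-allFin x) x≢top))

    order-respects-⊑ : ∀ {x y} → x ⊑ y → x ≢ y → Precedes x y order
    order-respects-⊑ {x} {y} x⊑y x≢y with ∈-++⁻ Others.list (∈-order x) | ∈-++⁻ Others.list (∈-order y)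
    ... | inj₂ (here refl) | _ = ⊥-elim (x≢y (sym (proj₁ topMax y (proj₂ x⊑y))))
    ... | inj₁ x∈ | inj₂ (here refl) = precedes-++⁺ Others.list [ top ] x∈ (here refl)
    ... | inj₁ x∈ | inj₁ y∈ = precedes-++⁺ˡ Others.list [ top ] (Others.respects-⊑ x⊑y x≢y x∈ y∈)

    position : Fin n → Fin (length order)
    position x = Any.index (∈-order x)

    lookup-position : ∀ x → lookup order (position x) ≡ x
    lookup-position x = sym (lookup-index (∈-order x))

    position-lookup : ∀ i → position (lookup order i) ≡ i
    position-lookup i = unique-lookup-index unique-order (∈-order (lookup order i)) i refl

    module Pieces = LabelledReach piece

    Respects⊑ : List (Fin n) → Set
    Respects⊑ M = ∀ {x y} → x ⊑ y → x ≢ y → x ∈ M → y ∈ M → Precedes x y M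

    respects-tail : ∀ {x M} → Unique (x ∷ M) → Respects⊑ (x ∷ M) → Respects⊑ M
    respects-tail (x∉ ∷ _) resp a⊑b a≢b a∈ b∈ =
      precedes-∷⁻ (λ a≡x → All.lookup x∉ a∈ (sym a≡x)) (resp a⊑b a≢b (there a∈) (there b∈))

    reach⇒≼ : ∀ M → Unique M → Respects⊑ M → ∀ i j → Pieces.Reach M i j → lookup M i ≼ lookup M j
    reach⇒≼ (x ∷ M) u resp fz     fz     _ = ≤.refl′ x
    reach⇒≼ (x ∷ M) u resp fz     (fs j) (k , cc , r) with ≤.concComp x (lookup M k) cc
    ... | inj₁ x≼k = ≤.trans′ _ _ _ x≼k (reach⇒≼ M (unique-++⁻ʳ [ x ] u) (respects-tail u resp) k j r)
    ... | inj₂ k≼x = ⊥-elim (unique⇒¬precedes-head u (resp (concurrent-sym cc , k≼x) k≢x (there (∈-lookup k)) (here refl)))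
      where k≢x = λ k≡x → All.lookup (AllPairs.head u) (subst (_∈ M) k≡x (∈-lookup k)) refl
    reach⇒≼ (x ∷ M) u resp (fs i) (fs j) r = reach⇒≼ M (unique-++⁻ʳ [ x ] u) (respects-tail u resp) i j r

    private module Classically (_≼?_ : DecidableOrder) where
      between : Fin n → Fin n → ℕ
      between x y = count (λ z → x ≼ z × z ≼ y) (λ z → (x ≼? z) ×-dec (z ≼? y))

      -- induction on the number of pieces between x and y; a covering pair is
      -- concurrent, so the listing puts it in order
      ≼⇒reach : ∀ k x y → between x y ≤ k → x ≼ y → Pieces.Reach order (position x) (position y)
      ≼⇒reach k x y bound x≼y with x ≟ y
      ... | yes refl = Pieces.reach-refl order (position x)
      ... | no x≢y with Fin.any? (λ z → ((x ≼? z) ×-dec (z ≼? y)) ×-dec (¬? (z ≟ x) ×-dec ¬? (z ≟ y)))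
      ≼⇒reach zero x y bound x≼y | no x≢y | _ =
        ⊥-elim (ℕ.<⇒≱ (count-positive (λ z → x ≼ z × z ≼ y) _ x (≤.refl′ x , x≼y)) bound)
      ≼⇒reach (suc k) x y bound x≼y | no x≢y | yes (z , (x≼z , z≼y) , (z≢x , z≢y)) =
        Pieces.reach-trans order (position x) (position z) (position y)
          (≼⇒reach k x z (ℕ.≤-pred (ℕ.≤-trans x-z<x-y bound)) x≼z)
          (≼⇒reach k z y (ℕ.≤-pred (ℕ.≤-trans z-y<x-y bound)) z≼y)
        where
          x-z<x-y : between x z < between x y
          x-z<x-y = count-mono-< _ _ _ _ (λ w (x≼w , w≼z) → x≼w , ≤.trans′ w z y w≼z z≼y) y (x≼y , ≤.refl′ y)
                      (λ (_ , y≼z) → z≢y (≤.antisym z y z≼y y≼z))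
          z-y<x-y : between z y < between x y
          z-y<x-y = count-mono-< _ _ _ _ (λ w (z≼w , w≼y) → ≤.trans′ x z w x≼z z≼w , w≼y) x (≤.refl′ x , x≼y)
                      (λ (z≼x , _) → z≢x (≤.antisym z x z≼x x≼z))
      ≼⇒reach (suc k) x y bound x≼y | no x≢y | no nothing-between =
        Pieces.reach-step order (position x) (position y)
          (precedes⇒index-< unique-order (order-respects-⊑ (cc , x≼y) x≢y) (∈-order x) (∈-order y))
          (subst₂ (λ a b → Concurrent D (piece a) (piece b)) (sym (lookup-position x)) (sym (lookup-position y)) cc)
        where
          cc : Concurrent D (piece x) (piece y)
          cc = ≤.coverConc x y ((x≼y , x≢y) ,
                 λ z ((x≼z , x≢z) , (z≼y , z≢y)) → nothing-between (z , (x≼z , z≼y) , (x≢z ∘ sym , z≢y)))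

      above : Fin n → ℕ
      above x = count (x ≼_) (x ≼?_)

      ≼top : ∀ k x → above x ≤ k → x ≼ top
      ≼top k x bound with Fin.any? (λ y → (x ≼? y) ×-dec ¬? (y ≟ x))
      ≼top zero    x bound | _ = ⊥-elim (ℕ.<⇒≱ (count-positive (x ≼_) _ x (≤.refl′ x)) bound)
      ≼top (suc k) x bound | yes (y , x≼y , y≢x) =
        ≤.trans′ x y top x≼y (≼top k y (ℕ.≤-pred (ℕ.≤-trans y<x bound)))
        where y<x : above y < above x
              y<x = count-mono-< _ _ _ _ (λ w y≼w → ≤.trans′ x y w x≼y y≼w) x (≤.refl′ x)
                      (λ y≼x → y≢x (≤.antisym y x y≼x x≼y))
      ≼top (suc k) x bound | no nothing-above =
        subst (x ≼_) (proj₂ topMax x maximal) (≤.refl′ x)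
        where maximal : IsMaximal D H x
              maximal y x≼y = decidable-stable (y ≟ x) (λ y≢x → nothing-above (y , x≼y , y≢x))

    order-reach? : ∀ i j → Dec (Pieces.Reach order i j)
    order-reach? = Pieces.reach? (λ x y → concurrent? (piece x) (piece y)) order

    ≼⇒reach : ∀ x y → x ≼ y → Pieces.Reach order (position x) (position y)
    ≼⇒reach x y x≼y = decidable-stable (order-reach? _ _)
      (λ ¬reach → ¬¬-decidableOrder (λ _≼?_ → ¬reach (Classically.≼⇒reach _≼?_ n x y (count-≤-size _ _) x≼y)))

    reach-top : ∀ i → Pieces.Reach order i (position top)
    reach-top i = decidable-stable (order-reach? _ _)
      (λ ¬reach → ¬¬-decidableOrder (λ _≼?_ → ¬reach
        (subst (λ i′ → Pieces.Reach order i′ (position top)) (position-lookup i)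
          (≼⇒reach (lookup order i) top (Classically.≼top _≼?_ n (lookup order i) (count-≤-size _ _))))))

    open Splicing piece

    private
      last-index : ∀ M → Fin (length (M ∷ʳ top))
      last-index []      = fz
      last-index (x ∷ M) = fs (last-index M)

      lookup-last-index : ∀ M → lookup (M ∷ʳ top) (last-index M) ≡ top
      lookup-last-index []      = refl
      lookup-last-index (x ∷ M) = lookup-last-index M

      meetsLater-from-reach : ∀ M → (∀ i → Pieces.Reach (M ∷ʳ top) i (last-index M)) → MeetsLater M [ top ]
      meetsLater-from-reach []      _     = tt
      meetsLater-from-reach (x ∷ M) reach with reach fz
      ... | k , cc , _ = (lookup (M ∷ʳ top) k , ∈-lookup k , cc) , meetsLater-from-reach M (reach ∘ fs)

    meetsLater : MeetsLater Others.list [ top ]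
    meetsLater = meetsLater-from-reach Others.list λ i →
      subst (Pieces.Reach order i)
            (unique-lookup-index unique-order (∈-order top) (last-index Others.list) (lookup-last-index Others.list))
            (reach-top i)

    build : ∀ {u e} → IsDecomposition D H → SplicedTrail u e [ top ] →
            ∃[ ws ] (IsEulerianTrail D u ws × EndsAt D e ws × HeapIso D (g D u ws) H)
    build {u} {e} decomposition base =
      T.ws , ((T.walk , unique-ws) , all∈) , T.ends-e ,
      subst (λ δs → HeapIso D (heapOf D δs) H) (sym (cycleSeq⇒cs T.cycleSeq)) heapIso
      where
        T = splice-all Others.list (All.tabulate (λ {x} _ → ≤.labelsCyc x)) meetsLater base
        module T = SplicedTrail T
        module Iso = ListHeapIso T.iso
        unique-ws : Unique T.ws
        unique-ws = unique-resp-↭ (↭-sym T.arcs↭)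
          (unique-arcsOfI order unique-order (All.tabulate (λ {x} _ → ≤.labelsCyc x))
            (λ x y a∈x a∈y → proj₂ (decomposition _) x y a∈x a∈y))
        all∈ : ∀ a → a ∈ T.ws
        all∈ a = let (x , a∈x) = proj₁ (decomposition a) in
                 Perm.∈-resp-↭ (↭-sym T.arcs↭) (∈-arcsOfI⁺ order (∈-order x) a∈x)
        to : Fin (length T.δs) → Fin n
        to i = lookup order (index⁺ T.rotated (Iso.to i))
        from : Fin n → Fin (length T.δs)
        from x = Iso.from (index⁻ T.rotated (position x))
        to-from : ∀ x → to (from x) ≡ x
        to-from x = begin
          lookup order (index⁺ T.rotated (Iso.to (Iso.from (index⁻ T.rotated (position x)))))
            ≡⟨ cong (lookup order ∘ index⁺ T.rotated) (Iso.to-from _) ⟩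
          lookup order (index⁺ T.rotated (index⁻ T.rotated (position x)))
            ≡⟨ cong (lookup order) (index⁺∘index⁻ T.rotated (position x)) ⟩
          lookup order (position x)
            ≡⟨ lookup-position x ⟩
          x ∎
          where open ≡-Reasoning
        from-to : ∀ i → from (to i) ≡ i
        from-to i = begin
          Iso.from (index⁻ T.rotated (position (lookup order (index⁺ T.rotated (Iso.to i)))))
            ≡⟨ cong (Iso.from ∘ index⁻ T.rotated) (position-lookup _) ⟩
          Iso.from (index⁻ T.rotated (index⁺ T.rotated (Iso.to i)))
            ≡⟨ cong Iso.from (index⁻∘index⁺ T.rotated (Iso.to i)) ⟩
          Iso.from (Iso.to i)
            ≡⟨ Iso.from-to i ⟩
          i ∎
          where open ≡-Reasoning
        heapIso : HeapIso D (heapOf D T.δs) H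
        heapIso = record
          { σ        = mk↔ₛ′ to from to-from from-to
          ; ordIso   = λ i j →
              (λ i≤j → reach⇒≼ order unique-order (λ x⊑y x≢y _ _ → order-respects-⊑ x⊑y x≢y) _ _
                         (rotated-reach⁺ T.rotated _ _ (Iso.reach⁺ i j (heapOrder⇒reach T.δs i j i≤j)))) ,
              (λ to-i≼to-j → reach⇒heapOrder T.δs i j (Iso.reach⁻ i j (rotated-reach⁻ T.rotated (Iso.to i) (Iso.to j)
                         (subst₂ (Pieces.Reach order) (position-lookup _) (position-lookup _) (≼⇒reach _ _ to-i≼to-j)))))
          ; labelIso = λ i → subst (λ γ → CycEq D γ (piece (to i))) (Iso.label i)
                                   (proj₁ (rotated-lookup T.rotated (Iso.to i)))
          }

  -- The two bijections

  eulerianTrailsEnding-bijection : ∀ e → GBijection D (Wᵉ D e) (dpᵉ D e)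
  eulerianTrailsEnding-bijection e = pyramid , injective , surjective
    where
      pyramid : ∀ u es → Wᵉ D e u es → dpᵉ D e (g D u es)
      pyramid u es (E , xs , refl) =
        g-decompPyramid (λ β → e ∈ cycArcs D β) E (∷ʳ≢[] xs) (λ A → Apex.last∈apex A xs e refl)
      start≡head : ∀ {u es} → Wᵉ D e u es → u ≡ head e
      start≡head {u} (((w , _) , _) , xs , refl) = sym (walk-last-head xs w)
      injective : ∀ u es u′ es′ → Wᵉ D e u es → Wᵉ D e u′ es′ → HeapIso D (g D u es) (g D u′ es′) → (u , es) ≡ (u′ , es′)
      injective u es u′ es′ W W′ iso with trans (start≡head W) (sym (start≡head W′))
      ... | refl = cong (u ,_) (eulerianTrails-heapIso⇒≡ (proj₁ W) (proj₁ W′) iso)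
      surjective : ∀ H → dpᵉ D e H → ∃[ u ] ∃[ es ] (Wᵉ D e u es × HeapIso D (g D u es) H)
      surjective H (isHeap , decomposition , top , topMax , e∈top) =
        let (ws , E , ends , iso) = Linearisation.build H isHeap top topMax decomposition
                                      (Splicing.singleTrail-ending (Heap.label H) (IsHeap.labelsCyc isHeap top) e∈top)
        in head e , ws , (E , ends) , iso

  eulerianTrailsAt-bijection : ∀ u → E D → GBijection D (Wᵘ D u) (dpᵘ D u)
  eulerianTrailsAt-bijection u a = pyramid , injective , surjective
    where
      pyramid : ∀ v es → Wᵘ D u v es → dpᵘ D u (g D v es)
      pyramid v es (E , refl) = g-decompPyramid (λ β → u ∈ cycVerts D β) E es≢[] Apex.start∈apex
        where es≢[] = λ { refl → case proj₂ E a of λ () }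
      injective : ∀ v es v′ es′ → Wᵘ D u v es → Wᵘ D u v′ es′ → HeapIso D (g D v es) (g D v′ es′) → (v , es) ≡ (v′ , es′)
      injective v es v′ es′ (E , refl) (E′ , refl) iso = cong (u ,_) (eulerianTrails-heapIso⇒≡ E E′ iso)
      surjective : ∀ H → dpᵘ D u H → ∃[ v ] ∃[ es ] (Wᵘ D u v es × HeapIso D (g D v es) H)
      surjective H (isHeap , decomposition , top , topMax , u∈top) =
        let (ws , E , _ , iso) = Linearisation.build H isHeap top topMax decomposition
                                   (proj₂ (Splicing.singleTrail (Heap.label H) (IsHeap.labelsCyc isHeap top) u∈top))
        in u , ws , (E , refl) , iso

mainTheorem11 : (D : MultiDigraph) → Connected D → Eulerian D →
    (u : V D) (e : E D) →
    GBijection D (Wᵉ D e) (dpᵉ D e) × GBijection D (Wᵘ D u) (dpᵘ D u)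
mainTheorem11 D _ _ u e = eulerianTrailsEnding-bijection e , eulerianTrailsAt-bijection u e
  where open Trails D
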